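{- For $n\geq 2$, the number of permutations $\pi\in\mathcal{S}_n$ with at most one descent such that $\operatorname{des}(\pi^2)\leq 2$ equals $2F_{n+3}-\left\lfloor\frac{(n+4)^2}{4}\right\rfloor+1$, where $F_m$ denotes the Fibonacci numbers with $F_1=F_2=1$.
   Context: $\mathcal{S}_n$ is the symmetric group on $[n]$; a permutation $\pi=\pi_1\cdots\pi_n$ (one-line notation, $\pi_i=\pi(i)$) has a descent at $i\in[n-1]$ if $\pi_i>\pi_{i+1}$, and $\operatorname{des}(\pi)$ is the number of descents. $\pi^2(i)=\pi(\pi(i))$. -}

module Defs where

open import Data.Nat using (ℕ; zero; suc; _+_; _*_; _<_; _≤_; _/_; _<ᵇ_; _≤?_; _<?_)
open import Data.Fin using (Fin; zero; suc; toℕ; inject₁)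
open import Data.Fin.Properties using (_≟_)
import Data.Vec
open import Data.Vec using (Vec; []; _∷_; lookup; tabulate)
open import Data.List using (List; []; _∷_; map; concatMap; filter; length; allFin)
open import Data.Product using (_×_; _,_)
open import Relation.Nullary using (Dec; yes; no; ¬_)
open import Relation.Nullary.Decidable using (_×-dec_; ¬?)
open import Relation.Unary using (Decidable)
open import Relation.Binary.PropositionalEquality using (_≡_)
open import Data.Fin.Properties using (all?)

F : ℕ → ℕ
F zero = 0
F (suc zero) = 1
F (suc (suc m)) = F m + F (suc m)

-- A map [n] → [n] in one-line notation: w = π₁ ⋯ πₙ (positions/values 0-indexed).
Word : ℕ → Set
Word n = Vec (Fin n) n

words : (n m : ℕ) → List (Vec (Fin n) m)
words n zero = [] ∷ []
words n (suc m) = concatMap (λ x → map (x ∷_) (words n m)) (allFin n)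

-- Injective (hence bijective, i.e. a permutation of [n]).
IsPerm : ∀ {n} → Word n → Set
IsPerm {n} w = ∀ (i j : Fin n) → lookup w i ≡ lookup w j → i ≡ j

isPerm? : ∀ {n} → Decidable (IsPerm {n})
isPerm? {n} w = all? λ i → all? λ j → dec i j
  where
  dec : (i j : Fin n) → Dec (lookup w i ≡ lookup w j → i ≡ j)
  dec i j with lookup w i ≟ lookup w j | i ≟ j
  ... | _ | yes p = yes (λ _ → p)
  ... | no q | no _ = yes (λ e → Data.Empty.⊥-elim (q e))
    where import Data.Empty
  ... | yes e | no q = no (λ f → q (f e))

square : ∀ {n} → Word n → Word n
square w = tabulate (λ i → lookup w (lookup w i))

desFrom : ∀ {m} → ℕ → Vec ℕ m → ℕ
desFrom p [] = 0
desFrom p (y ∷ xs) with y <? p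
... | yes _ = suc (desFrom y xs)
... | no _ = desFrom y xs

desList : ∀ {m} → Vec ℕ m → ℕ
desList [] = 0
desList (x ∷ xs) = desFrom x xs

des : ∀ {n} → Word n → ℕ
des w = desList (Data.Vec.map toℕ w)

Good : ∀ {n} → Word n → Set
Good w = IsPerm w × (des w ≤ 1 × des (square w) ≤ 2)

good? : ∀ {n} → Decidable (Good {n})
good? w = isPerm? w ×-dec (des w ≤? 1 ×-dec des (square w) ≤? 2)

count : ℕ → ℕ
count n = length (filter good? (words n n))

-- A permutation with at most one descent is Grassmannian: it is determined by the bit string s of
-- length n marking the positions its first block of K values is sent to (K the number of trues),
-- and s is unique unless the permutation is the identity. Split s = u ++ v with u of length K and
-- let d ≥ 1 be the number of falses of u, which is the number of trues of v. The square π² is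
-- increasing on the four intervals cut at c = K − d, K and K + d; it descends at c iff u is
-- unsorted, at K + d iff v is unsorted, and also at K when both are. So the non-identity good
-- permutations are the pairs (u, v) with d ≥ 1 and u or v sorted. By inclusion–exclusion there
-- are A + B − Σₖ min(k, n − k) of them, where A and B count strings with a bounded positive number
-- of trues, resp. falses: both satisfy a Fibonacci recursion and equal F(n+3) − n − 2, while
-- Σₖ min(k, n − k) = ⌊(n+4)²/4⌋ − 2n − 4.

module Submission where

open import Defs
open import Data.Nat using (ℕ; _+_; _*_; _∸_; _/_; _≤_)
open import Relation.Binary.PropositionalEquality using (_≡_)

open import Data.Bool using (Bool; true; false; if_then_else_; _∧_; _∨_)
open import Data.Bool.Properties using (∧-assoc; ∧-identityʳ) renaming (_≟_ to _≟ᵇ_)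
open import Data.Empty using (⊥; ⊥-elim)
open import Data.Fin as Fin using (Fin; toℕ; fromℕ<)
open import Data.Fin.Properties using (toℕ-injective; toℕ<n; toℕ-fromℕ<; pigeonhole; punchOut-injective)
import Data.Fin.Properties as Finₚ
open import Data.List using (List; []; _∷_; length; map; concatMap; _++_; filter; upTo; applyUpTo; take; drop; allFin)
open import Data.List.Properties
  using ( length-++; length-map; length-take; length-drop; length-applyUpTo; map-++; map-∘
        ; take++drop≡id; ∷-injective; ∷-injectiveˡ; ∷-injectiveʳ)
open import Data.List.Membership.Propositional using (_∈_; find; lose)
open import Data.List.Membership.Propositional.Properties
  using ( ∈-map⁺; ∈-map⁻; ∈-++⁺ˡ; ∈-++⁺ʳ; ∈-++⁻; ∈-concatMap⁺; ∈-concatMap⁻; ∈-filter⁺; ∈-filter⁻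
        ; ∈-upTo⁺; ∈-upTo⁻; ∈-allFin)
open import Data.List.Membership.Propositional.Properties.WithK using (unique∧set⇒bag)
open import Data.List.Relation.Binary.BagAndSetEquality using (∼bag⇒↭)
open import Data.List.Relation.Binary.Disjoint.Propositional using (Disjoint)
open import Data.List.Relation.Binary.Permutation.Propositional.Properties using (↭-length)
open import Data.List.Relation.Unary.Any using (here; there)
import Data.List.Relation.Unary.All as All
import Data.List.Relation.Unary.AllPairs as AllPairs
import Data.List.Relation.Unary.AllPairs.Properties as AllPairs
open import Data.List.Relation.Unary.Unique.Propositional using (Unique; []; _∷_)
import Data.List.Relation.Unary.Unique.Propositional.Properties as Unique
open import Data.Nat
open import Data.Nat.Properties
open import Algebra.Properties.CommutativeSemigroup +-commutativeSemigroup using (interchange)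
open import Data.Nat.DivMod using (+-distrib-/-∣ʳ; m*n/n≡m)
open import Data.Nat.Divisibility using (divides-refl)
open import Data.Nat.ListAction using (sum)
open import Data.Nat.ListAction.Properties using (sum-++)
open import Data.Nat.Solver using (module +-*-Solver)
open import Data.Product using (∃; _×_; _,_; proj₁; proj₂; uncurry; map₁)
open import Data.Sum using (_⊎_; inj₁; inj₂)
import Data.Sum as Sum
open import Data.Vec using (Vec; []; _∷_; lookup; tabulate)
import Data.Vec as Vec
open import Data.Vec.Properties using (tabulate∘lookup; tabulate-cong; lookup∘tabulate)
import Data.Vec.Properties as Vecₚ
open import Function using (_∘_; _⇔_; mk⇔; Equivalence)
open import Relation.Binary.Definitions using (tri<; tri≈; tri>)
open import Relation.Binary.PropositionalEquality
open import Relation.Nullary using (Dec; yes; no; does; ¬_)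
open import Relation.Nullary.Decidable using (_×-dec_; _⊎-dec_; dec-true; dec-false)
open import Relation.Unary using (Decidable)

-- Rank and select on bit strings

-- Positions are counted from 0, and bit reads false beyond the end of s.
bit : List Bool → ℕ → Bool
bit []      _       = false
bit (x ∷ s) zero    = x
bit (x ∷ s) (suc V) = bit s V

rank : Bool → List Bool → ℕ → ℕ
rank β s       zero    = 0
rank β []      (suc V) = 0
rank β (x ∷ s) (suc V) = if does (x ≟ᵇ β) then suc (rank β s V) else rank β s V

occ : Bool → List Bool → ℕ
occ β s = rank β s (length s)

select : Bool → List Bool → ℕ → ℕ
select β []      i = 0
select β (x ∷ s) i with does (x ≟ᵇ β) | i
... | true  | zero  = 0
... | true  | suc j = suc (select β s j)
... | false | _     = suc (select β s i)

rank-≤ : ∀ β s V → rank β s V ≤ V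
rank-≤ β s       zero    = z≤n
rank-≤ β []      (suc V) = z≤n
rank-≤ β (x ∷ s) (suc V) with x ≟ᵇ β
... | yes _ = s≤s (rank-≤ β s V)
... | no _  = m≤n⇒m≤1+n (rank-≤ β s V)

rank-mono : ∀ β s {V W} → V ≤ W → rank β s V ≤ rank β s W
rank-mono β s       {zero}            _         = z≤n
rank-mono β []      {suc V} {suc W} _         = z≤n
rank-mono β (x ∷ s) {suc V} {suc W} (s≤s V≤W) with x ≟ᵇ β
... | yes _ = s≤s (rank-mono β s V≤W)
... | no _  = rank-mono β s V≤W

rank-≤-occ : ∀ β s V → rank β s V ≤ occ β s
rank-≤-occ β s       zero    = z≤n
rank-≤-occ β []      (suc V) = z≤n
rank-≤-occ β (x ∷ s) (suc V) with x ≟ᵇ β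
... | yes _ = s≤s (rank-≤-occ β s V)
... | no _  = rank-≤-occ β s V

rank-length : ∀ β s V → length s ≤ V → rank β s V ≡ occ β s
rank-length β []      zero    _         = refl
rank-length β []      (suc V) _         = refl
rank-length β (x ∷ s) (suc V) (s≤s l) rewrite rank-length β s V l = refl

rank-hit : ∀ β s V → V < length s → bit s V ≡ β → rank β s (suc V) ≡ suc (rank β s V)
rank-hit β (x ∷ s) zero    _       refl with x ≟ᵇ x
... | yes _ = refl
... | no x≢x = ⊥-elim (x≢x refl)
rank-hit β (x ∷ s) (suc V) (s≤s l) e with x ≟ᵇ β
... | yes _ = cong suc (rank-hit β s V l e)
... | no _  = rank-hit β s V l e

rank-miss : ∀ β s V → bit s V ≢ β → rank β s (suc V) ≡ rank β s V
rank-miss β []      zero    _ = refl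
rank-miss β []      (suc V) _ = refl
rank-miss β (x ∷ s) zero    x≢β with x ≟ᵇ β
... | yes x≡β = ⊥-elim (x≢β x≡β)
... | no _    = refl
rank-miss β (x ∷ s) (suc V) ne with x ≟ᵇ β
... | yes _ = cong suc (rank-miss β s V ne)
... | no _  = rank-miss β s V ne

rank-flat : ∀ β s {W W′} → W ≤ W′ → (∀ {V} → W ≤ V → V < W′ → bit s V ≢ β) →
            rank β s W′ ≡ rank β s W
rank-flat β s {W′ = zero}   z≤n     _    = refl
rank-flat β s {W′ = suc W′} W≤1+W′ miss with m≤n⇒m<n∨m≡n W≤1+W′
... | inj₂ refl   = refl
... | inj₁ W<1+W′ = trans (rank-miss β s W′ (miss (s≤s⁻¹ W<1+W′) ≤-refl))
                      (rank-flat β s (s≤s⁻¹ W<1+W′) λ W≤V V<W′ → miss W≤V (m<n⇒m<1+n V<W′))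

rank-true+rank-false : ∀ s V → V ≤ length s → rank true s V + rank false s V ≡ V
rank-true+rank-false s           zero    _       = refl
rank-true+rank-false (true ∷ s)  (suc V) (s≤s l) = cong suc (rank-true+rank-false s V l)
rank-true+rank-false (false ∷ s) (suc V) (s≤s l) =
  trans (+-suc _ _) (cong suc (rank-true+rank-false s V l))

occ-true+occ-false : ∀ s → occ true s + occ false s ≡ length s
occ-true+occ-false s = rank-true+rank-false s (length s) ≤-refl

occ-true≤length : ∀ s → occ true s ≤ length s
occ-true≤length s = subst (occ true s ≤_) (occ-true+occ-false s) (m≤m+n _ _)

select-<-length : ∀ β s i → i < occ β s → select β s i < length s
select-<-length true  (true ∷ s)  zero    _ = s≤s z≤n
select-<-length false (false ∷ s) zero    _ = s≤s z≤n
select-<-length true  (true ∷ s)  (suc i) l = s≤s (select-<-length true s i (s≤s⁻¹ l))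
select-<-length false (false ∷ s) (suc i) l = s≤s (select-<-length false s i (s≤s⁻¹ l))
select-<-length true  (false ∷ s) i       l = s≤s (select-<-length true s i l)
select-<-length false (true ∷ s)  i       l = s≤s (select-<-length false s i l)

bit-select : ∀ β s i → i < occ β s → bit s (select β s i) ≡ β
bit-select true  (true ∷ s)  zero    _ = refl
bit-select false (false ∷ s) zero    _ = refl
bit-select true  (true ∷ s)  (suc i) l = bit-select true s i (s≤s⁻¹ l)
bit-select false (false ∷ s) (suc i) l = bit-select false s i (s≤s⁻¹ l)
bit-select true  (false ∷ s) i       l = bit-select true s i l
bit-select false (true ∷ s)  i       l = bit-select false s i l

rank-select : ∀ β s i → i < occ β s → rank β s (select β s i) ≡ i
rank-select true  (true ∷ s)  zero    _ = refl
rank-select false (false ∷ s) zero    _ = refl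
rank-select true  (true ∷ s)  (suc i) l = cong suc (rank-select true s i (s≤s⁻¹ l))
rank-select false (false ∷ s) (suc i) l = cong suc (rank-select false s i (s≤s⁻¹ l))
rank-select true  (false ∷ s) i       l = rank-select true s i l
rank-select false (true ∷ s)  i       l = rank-select false s i l

select-rank : ∀ β s V → V < length s → bit s V ≡ β → select β s (rank β s V) ≡ V
select-rank true  (true ∷ s)  zero    _       _ = refl
select-rank false (false ∷ s) zero    _       _ = refl
select-rank true  (true ∷ s)  (suc V) (s≤s l) e = cong suc (select-rank true s V l e)
select-rank false (false ∷ s) (suc V) (s≤s l) e = cong suc (select-rank false s V l e)
select-rank true  (false ∷ s) (suc V) (s≤s l) e = cong suc (select-rank true s V l e)
select-rank false (true ∷ s)  (suc V) (s≤s l) e = cong suc (select-rank false s V l e)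

rank<occ : ∀ β s V → V < length s → bit s V ≡ β → rank β s V < occ β s
rank<occ β s V V<len e = begin-strict
  rank β s V        <⟨ n<1+n _ ⟩
  suc (rank β s V)  ≡⟨ rank-hit β s V V<len e ⟨
  rank β s (suc V)  ≤⟨ rank-mono β s V<len ⟩
  occ β s           ∎
  where open ≤-Reasoning

select<⇒<rank : ∀ β s i V → i < occ β s → select β s i < V → i < rank β s V
select<⇒<rank β s i V i<occ sel<V = begin-strict
  i                              ≡⟨ rank-select β s i i<occ ⟨
  rank β s (select β s i)        <⟨ n<1+n _ ⟩
  suc (rank β s (select β s i))  ≡⟨ rank-hit β s _ (select-<-length β s i i<occ) (bit-select β s i i<occ) ⟨
  rank β s (suc (select β s i))  ≤⟨ rank-mono β s sel<V ⟩
  rank β s V                     ∎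
  where open ≤-Reasoning

<rank⇒select< : ∀ β s i V → i < rank β s V → select β s i < V
<rank⇒select< β s i V i<rank = ≰⇒> λ V≤sel → <⇒≱ i<rank
  (≤-trans (rank-mono β s V≤sel) (≤-reflexive (rank-select β s i (<-≤-trans i<rank (rank-≤-occ β s V)))))

rank≤⇒≤select : ∀ β s i V → i < occ β s → rank β s V ≤ i → V ≤ select β s i
rank≤⇒≤select β s i V i<occ rank≤i = ≮⇒≥ λ sel<V → <⇒≱ (select<⇒<rank β s i V i<occ sel<V) rank≤i

select-strictMono : ∀ β s {i j} → i < j → j < occ β s → select β s i < select β s j
select-strictMono β s {i} {j} i<j j<occ =
  <rank⇒select< β s i _ (subst (i <_) (sym (rank-select β s j j<occ)) i<j)

select-mono : ∀ β s {i j} → i ≤ j → j < occ β s → select β s i ≤ select β s j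
select-mono β s i≤j j<occ with m≤n⇒m<n∨m≡n i≤j
... | inj₁ i<j  = <⇒≤ (select-strictMono β s i<j j<occ)
... | inj₂ refl = ≤-refl

≤select : ∀ β s i → i < occ β s → i ≤ select β s i
≤select β s i i<occ = subst (_≤ select β s i) (rank-select β s i i<occ) (rank-≤ β s _)

select-injective : ∀ β s {i j} → i < occ β s → j < occ β s → select β s i ≡ select β s j → i ≡ j
select-injective β s {i} {j} i<occ j<occ e =
  trans (sym (rank-select β s i i<occ)) (trans (cong (rank β s) e) (rank-select β s j j<occ))

select-true≢select-false : ∀ s {i j} → i < occ true s → j < occ false s → select true s i ≢ select false s j
select-true≢select-false s i<occ j<occ e with
  trans (sym (bit-select true s _ i<occ)) (trans (cong (bit s) e) (bit-select false s _ j<occ))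
... | ()

rank-++ˡ : ∀ β u v {V} → V ≤ length u → rank β (u ++ v) V ≡ rank β u V
rank-++ˡ β u       v {zero}  _       = refl
rank-++ˡ β (x ∷ u) v {suc V} (s≤s l) with x ≟ᵇ β
... | yes _ = cong suc (rank-++ˡ β u v l)
... | no _  = rank-++ˡ β u v l

rank-++ʳ : ∀ β u v V → rank β (u ++ v) (length u + V) ≡ occ β u + rank β v V
rank-++ʳ β []      v V = refl
rank-++ʳ β (x ∷ u) v V with x ≟ᵇ β
... | yes _ = cong suc (rank-++ʳ β u v V)
... | no _  = rank-++ʳ β u v V

occ-++ : ∀ β u v → occ β (u ++ v) ≡ occ β u + occ β v
occ-++ β u v = trans (cong (rank β (u ++ v)) (length-++ u)) (rank-++ʳ β u v (length v))

bit-applyUpTo : ∀ g n {V} → V < n → bit (applyUpTo g n) V ≡ g V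
bit-applyUpTo g (suc n) {zero}  _         = refl
bit-applyUpTo g (suc n) {suc V} (s≤s V<n) = bit-applyUpTo (g ∘ suc) n V<n

bits-ext : ∀ s s′ → length s ≡ length s′ → (∀ {V} → V < length s → bit s V ≡ bit s′ V) → s ≡ s′
bits-ext []      []       _   _     = refl
bits-ext (x ∷ s) (x′ ∷ s′) len≡ same = cong₂ _∷_ (same (s≤s z≤n))
  (bits-ext s s′ (suc-injective len≡) λ V<len → same (s≤s V<len))

-- Grassmannian permutations

data Side (K : ℕ) : ℕ → Set where
  below : ∀ {x} → x < K → Side K x
  above : ∀ j → Side K (K + j)

side : ∀ K x → Side K x
side K x with x <? K
... | yes x<K = below x<K
... | no x≮K  = subst (Side K) (m+[n∸m]≡n (≮⇒≥ x≮K)) (above (x ∸ K))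

-- The Grassmannian permutation of s maps [0, occ true s) increasingly onto the positions of the
-- trues of s and the remaining points increasingly onto the positions of the falses; these are
-- exactly the permutations with at most one descent.
grassmannian : List Bool → ℕ → ℕ
grassmannian s x with x <? occ true s
... | yes _ = select true s x
... | no _  = select false s (x ∸ occ true s)

module _ (s : List Bool) where
  private
    K = occ true s
    E = occ false s
    n = length s

  grassmannian-below : ∀ {x} → x < K → grassmannian s x ≡ select true s x
  grassmannian-below {x} x<K with x <? K
  ... | yes _   = refl
  ... | no x≮K = ⊥-elim (x≮K x<K)

  grassmannian-above : ∀ j → grassmannian s (K + j) ≡ select false s j
  grassmannian-above j with K + j <? K
  ... | yes K+j<K = ⊥-elim (m+n≮m K j K+j<K)
  ... | no _      = cong (select false s) (m+n∸m≡n K j)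

  above-< : ∀ {j} → K + j < n → j < E
  above-< {j} K+j<n = +-cancelˡ-< K j E (subst (K + j <_) (sym (occ-true+occ-false s)) K+j<n)

  grassmannian-< : ∀ {x} → x < n → grassmannian s x < n
  grassmannian-< {x} x<n with side K x
  ... | below x<K = subst (_< n) (sym (grassmannian-below x<K)) (select-<-length true s x x<K)
  ... | above j   = subst (_< n) (sym (grassmannian-above j)) (select-<-length false s j (above-< x<n))

  grassmannian-injective : ∀ {x y} → x < n → y < n → grassmannian s x ≡ grassmannian s y → x ≡ y
  grassmannian-injective {x} {y} x<n y<n e with side K x | side K y
  ... | below x<K | below y<K = select-injective true s x<K y<K
    (trans (sym (grassmannian-below x<K)) (trans e (grassmannian-below y<K)))
  ... | below x<K | above j   = ⊥-elim (select-true≢select-false s x<K (above-< y<n)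
    (trans (sym (grassmannian-below x<K)) (trans e (grassmannian-above j))))
  ... | above i   | below y<K = ⊥-elim (select-true≢select-false s y<K (above-< x<n)
    (trans (sym (grassmannian-below y<K)) (trans (sym e) (grassmannian-above i))))
  ... | above i   | above j   = cong (K +_) (select-injective false s (above-< x<n) (above-< y<n)
    (trans (sym (grassmannian-above i)) (trans e (grassmannian-above j))))

  grassmannian-ascent : ∀ {x} → suc x < n → suc x ≢ K → grassmannian s x < grassmannian s (suc x)
  grassmannian-ascent {x} sx<n sx≢K with side K x
  ... | below x<K = subst₂ _<_ (sym (grassmannian-below x<K)) (sym (grassmannian-below sx<K))
                      (select-strictMono true s (n<1+n x) sx<K)
    where sx<K = ≤∧≢⇒< x<K sx≢K
  ... | above j   = subst (λ y → grassmannian s (K + j) < grassmannian s y) (+-suc K j)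
                      (subst₂ _<_ (sym (grassmannian-above j)) (sym (grassmannian-above (suc j)))
                        (select-strictMono false s (n<1+n j) (above-< (subst (_< n) (sym (+-suc K j)) sx<n))))

  grassmannian-blockwise : ∀ {x y} → x < y → y < n → y < K ⊎ K ≤ x → grassmannian s x < grassmannian s y
  grassmannian-blockwise x<y y<n (inj₁ y<K) =
    subst₂ _<_ (sym (grassmannian-below (<-trans x<y y<K))) (sym (grassmannian-below y<K))
      (select-strictMono true s x<y y<K)
  grassmannian-blockwise {x} {y} x<y y<n (inj₂ K≤x) with side K x | side K y
  ... | below x<K | _         = ⊥-elim (<⇒≱ x<K K≤x)
  ... | above i   | below y<K = ⊥-elim (<⇒≱ (<-trans x<y y<K) (m≤m+n K i))
  ... | above i   | above j   = subst₂ _<_ (sym (grassmannian-above i)) (sym (grassmannian-above j))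
                                  (select-strictMono false s (+-cancelˡ-< K i j x<y) (above-< y<n))

-- Descents

descents : (ℕ → ℕ) → ℕ → ℕ
descents f zero    = 0
descents f (suc m) with f (suc m) <? f m
... | yes _ = suc (descents f m)
... | no _  = descents f m

descents-cong : ∀ {f g} m → (∀ x → x ≤ m → f x ≡ g x) → descents f m ≡ descents g m
descents-cong zero _ = refl
descents-cong {f} {g} (suc m) f≗g with f (suc m) <? f m | g (suc m) <? g m
... | yes _ | yes _ = cong suc (descents-cong m (λ x x≤m → f≗g x (m≤n⇒m≤1+n x≤m)))
... | no _  | no _  = descents-cong m (λ x x≤m → f≗g x (m≤n⇒m≤1+n x≤m))
... | yes d | no ¬d = ⊥-elim (¬d (subst₂ _<_ (f≗g (suc m) ≤-refl) (f≗g m (n≤1+n m)) d))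
... | no ¬d | yes d = ⊥-elim (¬d (subst₂ _<_ (sym (f≗g (suc m) ≤-refl)) (sym (f≗g m (n≤1+n m))) d))

descents-suc : ∀ f m → descents f (suc m) ≡ descents (f ∘ suc) m + descents f 1
descents-suc f zero = refl
descents-suc f (suc m) with f (suc (suc m)) <? f (suc m)
... | yes _ = cong suc (descents-suc f m)
... | no _  = descents-suc f m

descents-≤-suc : ∀ f m → descents f m ≤ descents f (suc m)
descents-≤-suc f m with f (suc m) <? f m
... | yes _ = n≤1+n _
... | no _  = ≤-refl

descents-mono : ∀ f {m m′} → m ≤ m′ → descents f m ≤ descents f m′
descents-mono f {m} {zero}   z≤n = ≤-refl
descents-mono f {m} {suc m′} m≤1+m′ with m≤n⇒m<n∨m≡n m≤1+m′
... | inj₁ m<1+m′ = ≤-trans (descents-mono f (s≤s⁻¹ m<1+m′)) (descents-≤-suc f m′)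
... | inj₂ refl   = ≤-refl

descents-suc-hit : ∀ f i → f (suc i) < f i → descents f (suc i) ≡ suc (descents f i)
descents-suc-hit f i desc with f (suc i) <? f i
... | yes _     = refl
... | no ¬desc = ⊥-elim (¬desc desc)

descents-hit : ∀ f {i m} → i < m → f (suc i) < f i → suc (descents f i) ≤ descents f m
descents-hit f {i} i<m desc =
  subst (_≤ _) (descents-suc-hit f i desc) (descents-mono f i<m)

descents-≡0 : ∀ f m → (∀ i → i < m → ¬ f (suc i) < f i) → descents f m ≡ 0
descents-≡0 f zero    _      = refl
descents-≡0 f (suc m) ascent with f (suc m) <? f m
... | yes desc = ⊥-elim (ascent m ≤-refl desc)
... | no _     = descents-≡0 f m (λ i i<m → ascent i (m<n⇒m<1+n i<m))

descents-≤1 : ∀ f m p → (∀ i → i < m → f (suc i) < f i → i ≡ p) → descents f m ≤ 1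
descents-≤1 f zero    p _    = z≤n
descents-≤1 f (suc m) p only with f (suc m) <? f m
... | yes desc = s≤s (≤-reflexive (descents-≡0 f m λ i i<m d →
                   <-irrefl (trans (only i (m<n⇒m<1+n i<m) d) (sym (only m ≤-refl desc))) i<m))
... | no _     = descents-≤1 f m p (λ i i<m → only i (m<n⇒m<1+n i<m))

descents-≤2 : ∀ f m p q → (∀ i → i < m → f (suc i) < f i → i ≡ p ⊎ i ≡ q) → descents f m ≤ 2
descents-≤2 f zero    p q _    = z≤n
descents-≤2 f (suc m) p q only with f (suc m) <? f m
... | no _     = descents-≤2 f m p q (λ i i<m → only i (m<n⇒m<1+n i<m))
... | yes desc with only m ≤-refl desc
...   | inj₁ refl = s≤s (descents-≤1 f m q λ i i<m d → earlier i i<m d λ i≡m → <-irrefl i≡m i<m)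
  where
  earlier : ∀ i → i < m → f (suc i) < f i → i ≢ m → i ≡ q
  earlier i i<m d i≢m with only i (m<n⇒m<1+n i<m) d
  ... | inj₁ i≡m = ⊥-elim (i≢m i≡m)
  ... | inj₂ i≡q = i≡q
...   | inj₂ refl = s≤s (descents-≤1 f m p λ i i<m d → earlier i i<m d λ i≡m → <-irrefl i≡m i<m)
  where
  earlier : ∀ i → i < m → f (suc i) < f i → i ≢ m → i ≡ p
  earlier i i<m d i≢m with only i (m<n⇒m<1+n i<m) d
  ... | inj₁ i≡p = i≡p
  ... | inj₂ i≡m = ⊥-elim (i≢m i≡m)

descents-≥2 : ∀ f {i j m} → i < j → j < m → f (suc i) < f i → f (suc j) < f j → 2 ≤ descents f m
descents-≥2 f i<j j<m dᵢ dⱼ =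
  ≤-trans (s≤s (≤-trans (s≤s z≤n) (descents-hit f i<j dᵢ))) (descents-hit f j<m dⱼ)

descents-≥3 : ∀ f {i j k m} → i < j → j < k → k < m →
              f (suc i) < f i → f (suc j) < f j → f (suc k) < f k → 3 ≤ descents f m
descents-≥3 f i<j j<k k<m dᵢ dⱼ dₖ = ≤-trans (s≤s (descents-≥2 f i<j j<k dᵢ dⱼ)) (descents-hit f k<m dₖ)

descents-≤1⇒boundary : ∀ f m → descents f m ≤ 1 →
                       ∃ λ k → k ≤ m × (∀ {i} → i < m → f (suc i) < f i → suc i ≡ k)
descents-≤1⇒boundary f m ≤1 with anyUpTo? (λ i → f (suc i) <? f i) m
... | no none = m , ≤-refl , λ i<m dᵢ → ⊥-elim (none (_ , i<m , dᵢ))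
... | yes (p , p<m , dₚ) = suc p , p<m , only-p
  where
  only-p : ∀ {i} → i < m → f (suc i) < f i → suc i ≡ suc p
  only-p {i} i<m dᵢ with <-cmp i p
  ... | tri< i<p _ _ = ⊥-elim (<⇒≱ (descents-≥2 f i<p p<m dᵢ dₚ) ≤1)
  ... | tri≈ _ i≡p _ = cong suc i≡p
  ... | tri> _ _ p<i = ⊥-elim (<⇒≱ (descents-≥2 f p<i i<m dₚ dᵢ) ≤1)

-- Words as functions on ℕ

nth : ∀ {m} → Vec ℕ m → ℕ → ℕ
nth []       _       = 0
nth (x ∷ xs) zero    = x
nth (x ∷ xs) (suc i) = nth xs i

-- The value beyond the length of the word is junk (0).
⟦_⟧ : ∀ {n m} → Vec (Fin n) m → ℕ → ℕ
⟦ w ⟧ = nth (Vec.map toℕ w)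

desFrom≡descents : ∀ {m} p (xs : Vec ℕ m) → desFrom p xs ≡ descents (nth (p ∷ xs)) m
desFrom≡descents p [] = refl
desFrom≡descents {suc m} p (y ∷ xs) = trans first-step (sym (descents-suc (nth (p ∷ y ∷ xs)) m))
  where
  first-step : desFrom p (y ∷ xs) ≡ descents (nth (y ∷ xs)) m + descents (nth (p ∷ y ∷ xs)) 1
  first-step with y <? p
  ... | yes _ = trans (cong suc (desFrom≡descents y xs)) (+-comm 1 _)
  ... | no _  = trans (desFrom≡descents y xs) (sym (+-identityʳ _))

des≡descents : ∀ {n} (w : Word n) f → (∀ x → x < n → ⟦ w ⟧ x ≡ f x) → des w ≡ descents f (pred n)
des≡descents []      f _   = refl
des≡descents (y ∷ w) f w≗f = trans (desFrom≡descents (toℕ y) (Vec.map toℕ w))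
  (descents-cong _ (λ x x≤ → w≗f x (s≤s x≤)))

⟦⟧-lookup : ∀ {n m} (w : Vec (Fin n) m) i → ⟦ w ⟧ (toℕ i) ≡ toℕ (lookup w i)
⟦⟧-lookup (y ∷ w) Fin.zero    = refl
⟦⟧-lookup (y ∷ w) (Fin.suc i) = ⟦⟧-lookup w i

⟦⟧-fromℕ< : ∀ {n} (w : Word n) {x} (x<n : x < n) → ⟦ w ⟧ x ≡ toℕ (lookup w (fromℕ< x<n))
⟦⟧-fromℕ< w x<n = trans (cong ⟦ w ⟧ (sym (toℕ-fromℕ< x<n))) (⟦⟧-lookup w (fromℕ< x<n))

⟦⟧-< : ∀ {n} (w : Word n) {x} → x < n → ⟦ w ⟧ x < n
⟦⟧-< w x<n = subst (_< _) (sym (⟦⟧-fromℕ< w x<n)) (toℕ<n _)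

⟦⟧-ext : ∀ {n} (w w′ : Word n) → (∀ x → x < n → ⟦ w ⟧ x ≡ ⟦ w′ ⟧ x) → w ≡ w′
⟦⟧-ext w w′ w≗w′ = trans (sym (tabulate∘lookup w)) (trans (tabulate-cong pointwise) (tabulate∘lookup w′))
  where
  pointwise : ∀ i → lookup w i ≡ lookup w′ i
  pointwise i = toℕ-injective
    (trans (sym (⟦⟧-lookup w i)) (trans (w≗w′ (toℕ i) (toℕ<n i)) (⟦⟧-lookup w′ i)))

⟦square⟧ : ∀ {n} (w : Word n) {x} → x < n → ⟦ square w ⟧ x ≡ ⟦ w ⟧ (⟦ w ⟧ x)
⟦square⟧ w {x} x<n = begin
  ⟦ square w ⟧ x               ≡⟨ ⟦⟧-fromℕ< (square w) x<n ⟩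
  toℕ (lookup (square w) i)    ≡⟨ cong toℕ (lookup∘tabulate _ i) ⟩
  toℕ (lookup w (lookup w i))  ≡⟨ ⟦⟧-lookup w (lookup w i) ⟨
  ⟦ w ⟧ (toℕ (lookup w i))     ≡⟨ cong ⟦ w ⟧ (⟦⟧-fromℕ< w x<n) ⟨
  ⟦ w ⟧ (⟦ w ⟧ x)              ∎
  where
  open ≡-Reasoning
  i = fromℕ< x<n

clamp : ∀ {n} → ℕ → Fin n → Fin n
clamp {n} y i with y <? n
... | yes y<n = fromℕ< y<n
... | no _    = i

toℕ-clamp : ∀ {n} y (i : Fin n) → y < n → toℕ (clamp y i) ≡ y
toℕ-clamp {n} y i y<n with y <? n
... | yes _    = toℕ-fromℕ< _
... | no y≮n = ⊥-elim (y≮n y<n)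

-- Outside [0, n) the function is junk: the entry at i then falls back to i itself.
fromFun : (n : ℕ) → (ℕ → ℕ) → Word n
fromFun n f = tabulate λ i → clamp (f (toℕ i)) i

⟦fromFun⟧ : ∀ n f {x} → x < n → f x < n → ⟦ fromFun n f ⟧ x ≡ f x
⟦fromFun⟧ n f {x} x<n fx<n = begin
  ⟦ fromFun n f ⟧ x                               ≡⟨ ⟦⟧-fromℕ< (fromFun n f) x<n ⟩
  toℕ (lookup (fromFun n f) i)                    ≡⟨ cong toℕ (lookup∘tabulate _ i) ⟩
  toℕ (clamp (f (toℕ i)) i)                       ≡⟨ cong (λ y → toℕ (clamp (f y) i)) (toℕ-fromℕ< x<n) ⟩
  toℕ (clamp (f x) i)                             ≡⟨ toℕ-clamp (f x) i fx<n ⟩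
  f x                                             ∎
  where
  open ≡-Reasoning
  i = fromℕ< x<n

IsPerm⇒⟦⟧-injective : ∀ {n} (w : Word n) → IsPerm w →
                      ∀ {x y} → x < n → y < n → ⟦ w ⟧ x ≡ ⟦ w ⟧ y → x ≡ y
IsPerm⇒⟦⟧-injective w perm {x} {y} x<n y<n e = begin
  x                   ≡⟨ toℕ-fromℕ< x<n ⟨
  toℕ (fromℕ< x<n)    ≡⟨ cong toℕ (perm _ _ (toℕ-injective
                            (trans (sym (⟦⟧-fromℕ< w x<n)) (trans e (⟦⟧-fromℕ< w y<n))))) ⟩
  toℕ (fromℕ< y<n)    ≡⟨ toℕ-fromℕ< y<n ⟩
  y                   ∎
  where open ≡-Reasoning

⟦⟧-injective⇒IsPerm : ∀ {n} (w : Word n) →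
                      (∀ {x y} → x < n → y < n → ⟦ w ⟧ x ≡ ⟦ w ⟧ y → x ≡ y) → IsPerm w
⟦⟧-injective⇒IsPerm w inj i j e = toℕ-injective (inj (toℕ<n i) (toℕ<n j)
  (trans (⟦⟧-lookup w i) (trans (cong toℕ e) (sym (⟦⟧-lookup w j)))))

injective⇒surjective : ∀ {n} (f : Fin n → Fin n) → (∀ i j → f i ≡ f j → i ≡ j) → ∀ v → ∃ λ i → f i ≡ v
injective⇒surjective {zero}  f inj ()
injective⇒surjective {suc n} f inj v with Finₚ.any? (λ i → f i Finₚ.≟ v)
... | yes hit = hit
... | no miss with pigeonhole (n<1+n n) (λ i → Fin.punchOut {i = v} {j = f i} (λ e → miss (i , sym e)))
... | i , j , i<j , e = ⊥-elim (Finₚ.<⇒≢ i<j (inj i j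
        (punchOut-injective (λ e′ → miss (i , sym e′)) (λ e′ → miss (j , sym e′)) e)))

IsPerm⇒⟦⟧-surjective : ∀ {n} (w : Word n) → IsPerm w → ∀ {V} → V < n → ∃ λ x → x < n × ⟦ w ⟧ x ≡ V
IsPerm⇒⟦⟧-surjective w perm V<n with injective⇒surjective (lookup w) perm (fromℕ< V<n)
... | i , e = toℕ i , toℕ<n i , trans (⟦⟧-lookup w i) (trans (cong toℕ e) (toℕ-fromℕ< V<n))

-- The square of a Grassmannian permutation

-- With K = occ true s: swapped s is the number of falses among the first K bits (0 exactly for
-- the identity), and PrefixSorted s, SuffixSorted s say that the first K bits, resp. the
-- remaining ones, are sorted with their trues first.
swapped : List Bool → ℕ
swapped s = rank false s (occ true s)

PrefixSorted : List Bool → Set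
PrefixSorted s = rank true s c ≡ c
  where c = rank true s (occ true s)

SuffixSorted : List Bool → Set
SuffixSorted s = rank true s (occ true s + swapped s) ≡ occ true s

<-of-+≡+ : ∀ {a b c j} → a + b ≡ c + j → a < c → j < b
<-of-+≡+ e a<c = ≰⇒> λ b≤j → <-irrefl e (+-mono-<-≤ a<c b≤j)

<pred⇒suc< : ∀ {i n} → i < pred n → suc i < n
<pred⇒suc< {n = suc n} = s≤s

module _ (s : List Bool) where
  private
    n = length s
    K = occ true s
    E = occ false s
    c = rank true s K
    d = swapped s
    π = grassmannian s
    π² : ℕ → ℕ
    π² x = π (π x)

  private
    K≤n : K ≤ n
    K≤n = occ-true≤length s

    c+d≡K : c + d ≡ K
    c+d≡K = rank-true+rank-false s K K≤n

    c≤K : c ≤ K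
    c≤K = subst (c ≤_) c+d≡K (m≤m+n c d)

    d≤E : d ≤ E
    d≤E = rank-mono false s K≤n

    K+d≤n : K + d ≤ n
    K+d≤n = subst (K + d ≤_) (occ-true+occ-false s) (+-monoʳ-≤ K d≤E)

    c<K : 1 ≤ d → c < K
    c<K 1≤d = subst (c <_) c+d≡K (m<m+n c 1≤d)

    π-<K-below : ∀ {x} → x < c → π x < K
    π-<K-below {x} x<c = subst (_< K) (sym (grassmannian-below s (<-≤-trans x<c c≤K)))
      (<rank⇒select< true s x K x<c)

    π-≥K-below : ∀ {x} → c ≤ x → x < K → K ≤ π x
    π-≥K-below {x} c≤x x<K = subst (K ≤_) (sym (grassmannian-below s x<K))
      (rank≤⇒≤select true s x K x<K c≤x)

    π-<K-above : ∀ {j} → j < d → π (K + j) < K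
    π-<K-above {j} j<d = subst (_< K) (sym (grassmannian-above s j)) (<rank⇒select< false s j K j<d)

    π-≥K-above : ∀ {j} → d ≤ j → j < E → K ≤ π (K + j)
    π-≥K-above {j} d≤j j<E = subst (K ≤_) (sym (grassmannian-above s j))
      (rank≤⇒≤select false s j K j<E d≤j)

  -- π² is increasing on each of [0, c), [c, K), [K, K + d) and [K + d, n): π maps each of them
  -- increasingly into a single one of its blocks [0, K) and [K, n).
  π²-ascent : ∀ {x} → suc x < n → suc x ≢ c → suc x ≢ K → suc x ≢ K + d → π² x < π² (suc x)
  π²-ascent {x} sx<n sx≢c sx≢K sx≢K+d =
    grassmannian-blockwise s (grassmannian-ascent s sx<n sx≢K) (grassmannian-< s sx<n) same-block
    where
    same-block : π (suc x) < K ⊎ K ≤ π x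
    same-block with side K x
    ... | below x<K with suc x <? c
    ...   | yes sx<c = inj₁ (π-<K-below sx<c)
    ...   | no sx≮c = inj₂ (π-≥K-below (s≤s⁻¹ (≤∧≢⇒< (≮⇒≥ sx≮c) (sx≢c ∘ sym))) x<K)
    same-block | above j with suc j <? d
    ...   | yes sj<d = inj₁ (subst (λ y → π y < K) (+-suc K j) (π-<K-above sj<d))
    ...   | no sj≮d = inj₂ (π-≥K-above d≤j (above-< s (<-trans (n<1+n _) sx<n)))
      where
      d≤j : d ≤ j
      d≤j = s≤s⁻¹ (≤∧≢⇒< (≮⇒≥ sj≮d) λ d≡sj → sx≢K+d (trans (sym (+-suc K j)) (cong (K +_) (sym d≡sj))))

  prefixSorted⇒ascent : 1 ≤ d → PrefixSorted s → ∀ {i} → suc i ≡ c → π² i < π² (suc i)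
  prefixSorted⇒ascent 1≤d sorted {i} si≡c = subst (λ y → π² i < π² y) (sym si≡c)
    (<-≤-trans (small (small (subst (i <_) si≡c (n<1+n i))))
      (large (π-≥K-below ≤-refl (c<K 1≤d)) (grassmannian-< s (<-≤-trans (c<K 1≤d) K≤n))))
    where
    no-false : rank false s c ≡ 0
    no-false = +-cancelˡ-≡ c _ 0 (trans (subst (λ r → r + rank false s c ≡ c) sorted
      (rank-true+rank-false s c (≤-trans c≤K K≤n))) (sym (+-identityʳ c)))
    small : ∀ {x} → x < c → π x < c
    small {x} x<c = subst (_< c) (sym (grassmannian-below s (<-≤-trans x<c c≤K)))
      (<rank⇒select< true s x c (subst (x <_) (sym sorted) x<c))
    large : ∀ {y} → K ≤ y → y < n → c ≤ π y
    large {y} K≤y y<n with side K y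
    ... | below y<K = ⊥-elim (<⇒≱ y<K K≤y)
    ... | above j   = subst (c ≤_) (sym (grassmannian-above s j))
      (rank≤⇒≤select false s j c (above-< s y<n) (subst (_≤ j) (sym no-false) z≤n))

  private
    ¬suffixSorted⇒K+d<n : ¬ SuffixSorted s → K + d < n
    ¬suffixSorted⇒K+d<n unsorted = ≤∧≢⇒< K+d≤n λ K+d≡n →
      unsorted (trans (cong (rank true s) K+d≡n) (rank-length true s n ≤-refl))

    second-block : 1 ≤ d → ∀ {i} → suc i ≡ K + d → ∃ λ e → i ≡ K + e × suc e ≡ d
    second-block 1≤d {i} si≡K+d with side K i
    ... | below i<K = ⊥-elim (<-irrefl si≡K+d (<-≤-trans (s≤s i<K) (m<m+n K 1≤d)))
    ... | above e   = e , refl , +-cancelˡ-≡ K _ _ (trans (+-suc K e) si≡K+d)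

  suffixSorted⇒ascent : 1 ≤ d → SuffixSorted s → ∀ {i} → suc i ≡ K + d → suc i < n → π² i < π² (suc i)
  suffixSorted⇒ascent 1≤d sorted {i} si≡K+d si<n with second-block 1≤d si≡K+d
  ... | e , refl , se≡d = subst (λ y → π² (K + e) < π² y) (sym si≡K+d)
    (<-≤-trans (small (π-<K-above (subst (e <_) se≡d (n<1+n e))))
      (large (large ≤-refl K+d<n) (grassmannian-< s K+d<n)))
    where
    K+d<n = subst (_< n) si≡K+d si<n
    all-false : rank false s (K + d) ≡ d
    all-false = +-cancelˡ-≡ K _ _ (subst (λ r → r + rank false s (K + d) ≡ K + d) sorted
      (rank-true+rank-false s (K + d) K+d≤n))
    small : ∀ {x} → x < K → π x < K + d
    small {x} x<K = subst (_< K + d) (sym (grassmannian-below s x<K))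
      (<rank⇒select< true s x (K + d) (subst (x <_) (sym sorted) x<K))
    large : ∀ {y} → K + d ≤ y → y < n → K + d ≤ π y
    large {y} K+d≤y y<n with side K y
    ... | below y<K = ⊥-elim (<⇒≱ y<K (≤-trans (m≤m+n K d) K+d≤y))
    ... | above j   = subst (K + d ≤_) (sym (grassmannian-above s j)) (rank≤⇒≤select false s j (K + d)
      (above-< s y<n) (subst (_≤ j) (sym all-false) (+-cancelˡ-≤ K d j K+d≤y)))

  ¬prefixSorted⇒descent : 1 ≤ d → ¬ PrefixSorted s → ∀ {i} → suc i ≡ c → π² (suc i) < π² i
  ¬prefixSorted⇒descent 1≤d unsorted {i} si≡c = subst (λ y → π² y < π² i) (sym si≡c)
    (<-≤-trans π²c<πc πc≤π²i)
    where
    i<c = subst (i <_) si≡c (n<1+n i)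
    c<K′ = c<K 1≤d
    π²c<πc : π² c < π c
    π²c<πc with m≤n⇒∃[o]m+o≡n (π-≥K-below ≤-refl c<K′)
    ... | j , K+j≡πc = subst (λ y → π y < y) K+j≡πc
      (subst (_< K + j) (sym (grassmannian-above s j)) (<rank⇒select< false s j (K + j) j<rank))
      where
      rank-true : rank true s (K + j) ≡ c
      rank-true = trans (cong (rank true s) (trans K+j≡πc (grassmannian-below s c<K′)))
        (rank-select true s c c<K′)
      j<rank : j < rank false s (K + j)
      j<rank = <-of-+≡+ (trans (cong (_+ rank false s (K + j)) (sym rank-true)) (rank-true+rank-false s (K + j)
        (subst (_≤ n) (sym K+j≡πc) (<⇒≤ (grassmannian-< s (<-≤-trans c<K′ K≤n)))))) c<K′
    a = select true s i
    c≤a : c ≤ a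
    c≤a = rank≤⇒≤select true s i c (<-trans i<c c<K′)
      (s≤s⁻¹ (subst (rank true s c <_) (sym si≡c) (≤∧≢⇒< (rank-≤ true s c) unsorted)))
    a<K : a < K
    a<K = <rank⇒select< true s i K i<c
    πc≤π²i : π c ≤ π² i
    πc≤π²i = subst₂ _≤_ (sym (grassmannian-below s c<K′))
      (sym (trans (cong π (grassmannian-below s (<-trans i<c c<K′))) (grassmannian-below s a<K)))
      (select-mono true s c≤a a<K)

  ¬suffixSorted⇒descent : 1 ≤ d → ¬ SuffixSorted s → ∀ {i} → suc i ≡ K + d → π² (suc i) < π² i
  ¬suffixSorted⇒descent 1≤d unsorted {i} si≡K+d with second-block 1≤d si≡K+d
  ... | e , refl , se≡d = subst (λ y → π² y < π² (K + e)) (sym si≡K+d) (≤-<-trans π²[K+d]≤b b<π²[K+e])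
    where
    e<d = subst (e <_) se≡d (n<1+n e)
    d<E = above-< s (¬suffixSorted⇒K+d<n unsorted)
    b = select false s e
    b<K : b < K
    b<K = <rank⇒select< false s e K e<d
    b<π²[K+e] : b < π² (K + e)
    b<π²[K+e] = subst (b <_) (sym (trans (cong π (grassmannian-above s e)) (grassmannian-below s b<K)))
      (≤∧≢⇒< (≤select true s b b<K) λ b≡ → select-true≢select-false s b<K (<-≤-trans e<d d≤E) (sym b≡))
    d<rank : d < rank false s (K + d)
    d<rank = <-of-+≡+ (rank-true+rank-false s (K + d) K+d≤n)
      (≤∧≢⇒< (rank-≤-occ true s (K + d)) unsorted)
    π²[K+d]≤b : π² (K + d) ≤ b
    π²[K+d]≤b with m≤n⇒∃[o]m+o≡n (π-≥K-above ≤-refl d<E)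
    ... | j , K+j≡π[K+d] = subst (λ y → π y ≤ b) K+j≡π[K+d]
      (subst (_≤ b) (sym (grassmannian-above s j)) (select-mono false s j≤e (<-≤-trans e<d d≤E)))
      where
      j≤e : j ≤ e
      j≤e = s≤s⁻¹ (subst (j <_) (sym se≡d) (+-cancelˡ-< K j d (subst (_< K + d) (sym K+j≡π[K+d])
        (subst (_< K + d) (sym (grassmannian-above s d)) (<rank⇒select< false s d (K + d) d<rank)))))

  unsorted⇒descent : ¬ PrefixSorted s → ¬ SuffixSorted s → ∀ {q} → suc q ≡ K → π² (suc q) < π² q
  unsorted⇒descent unsorted₁ unsorted₂ {q} sq≡K = <-≤-trans π²[sq]<K K≤π²q
    where
    q<K = subst (q <_) sq≡K (n<1+n q)
    b<c : select false s 0 < c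
    b<c = <rank⇒select< false s 0 c (<-of-+≡+
      (trans (rank-true+rank-false s c (≤-trans c≤K K≤n)) (sym (+-identityʳ c)))
      (≤∧≢⇒< (rank-≤ true s c) unsorted₁))
    π²[sq]<K : π² (suc q) < K
    π²[sq]<K = subst (λ y → π y < K) (sym (trans (cong π (trans sq≡K (sym (+-identityʳ K))))
      (grassmannian-above s 0))) (π-<K-below b<c)
    K+d≤πq : K + d ≤ π q
    K+d≤πq = subst (K + d ≤_) (sym (grassmannian-below s q<K)) (rank≤⇒≤select true s q (K + d) q<K
      (s≤s⁻¹ (subst (rank true s (K + d) <_) (sym sq≡K) (≤∧≢⇒< (rank-≤-occ true s (K + d)) unsorted₂))))
    K≤π²q : K ≤ π² q
    K≤π²q with m≤n⇒∃[o]m+o≡n (≤-trans (m≤m+n K d) K+d≤πq)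
    ... | j , K+j≡πq = subst (λ y → K ≤ π y) K+j≡πq (π-≥K-above
      (+-cancelˡ-≤ K d j (subst (K + d ≤_) (sym K+j≡πq) K+d≤πq))
      (above-< s (subst (_< n) (sym K+j≡πq) (grassmannian-< s (<-≤-trans q<K K≤n)))))

  grassmannian-descent : 1 ≤ d → ∃ λ q → suc q ≡ K × suc q < n × π (suc q) < π q
  grassmannian-descent 1≤d = q , sq≡K , subst (_< n) (sym sq≡K) K<n ,
    <-≤-trans (subst (λ y → π y < K) (sym (trans sq≡K (sym (+-identityʳ K)))) (π-<K-above 1≤d))
      (π-≥K-below (s≤s⁻¹ (subst (c <_) (sym sq≡K) (c<K 1≤d))) (subst (q <_) sq≡K (n<1+n q)))
    where
    q = pred K
    sq≡K = suc-pred K {{>-nonZero (≤-<-trans z≤n (c<K 1≤d))}}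
    K<n = <-≤-trans (m<m+n K 1≤d) K+d≤n

  private
    c≡K : d ≡ 0 → c ≡ K
    c≡K d≡0 = trans (sym (+-identityʳ c)) (trans (cong (c +_) (sym d≡0)) c+d≡K)

  swapped≡0⇒identity : d ≡ 0 → ∀ {x} → x < n → π x ≡ x
  swapped≡0⇒identity d≡0 {x} x<n with side K x
  ... | below x<K = begin
    π x                                    ≡⟨ grassmannian-below s x<K ⟩
    select true s x                        ≡⟨ rank-true-≡ (<⇒≤ a<K) ⟨
    rank true s (select true s x)          ≡⟨ rank-select true s x x<K ⟩
    x                                      ∎
    where
    open ≡-Reasoning
    rank-true-≡ : ∀ {V} → V ≤ K → rank true s V ≡ V
    rank-true-≡ {V} V≤K = trans (sym (+-identityʳ _)) (trans
      (cong (rank true s V +_) (sym (n≤0⇒n≡0 (subst (rank false s V ≤_) d≡0 (rank-mono false s V≤K)))))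
      (rank-true+rank-false s V (≤-trans V≤K K≤n)))
    a<K : select true s x < K
    a<K = <rank⇒select< true s x K (subst (x <_) (sym (c≡K d≡0)) x<K)
  ... | above j with m≤n⇒∃[o]m+o≡n (rank≤⇒≤select false s j K (above-< s x<n) (subst (_≤ j) (sym d≡0) z≤n))
  ...   | j′ , K+j′≡b = trans (grassmannian-above s j) (trans (sym K+j′≡b) (cong (K +_) j′≡j))
    where
    open ≡-Reasoning
    j<E = above-< s x<n
    K+j′≤n : K + j′ ≤ n
    K+j′≤n = subst (_≤ n) (sym K+j′≡b) (<⇒≤ (select-<-length false s j j<E))
    rank-true : rank true s (K + j′) ≡ K
    rank-true = ≤-antisym (rank-≤-occ true s (K + j′))
      (subst (_≤ rank true s (K + j′)) (c≡K d≡0) (rank-mono true s (m≤m+n K j′)))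
    j′≡j : j′ ≡ j
    j′≡j = +-cancelˡ-≡ K j′ j (begin
      K + j′                                         ≡⟨ rank-true+rank-false s (K + j′) K+j′≤n ⟨
      rank true s (K + j′) + rank false s (K + j′)   ≡⟨ cong₂ _+_ rank-true (cong (rank false s) K+j′≡b) ⟩
      K + rank false s (select false s j)            ≡⟨ cong (K +_) (rank-select false s j j<E) ⟩
      K + j                                          ∎)

  descents-grassmannian : descents π (pred n) ≤ 1
  descents-grassmannian = descents-≤1 π (pred n) (pred K) only-at-K
    where
    only-at-K : ∀ i → i < pred n → π (suc i) < π i → i ≡ pred K
    only-at-K i i<pn desc with suc i ≟ K
    ... | yes si≡K = cong pred si≡K
    ... | no si≢K  = ⊥-elim (<-asym desc (grassmannian-ascent s (<pred⇒suc< i<pn) si≢K))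

  descents-π²-≤2 : 1 ≤ d → PrefixSorted s ⊎ SuffixSorted s → descents π² (pred n) ≤ 2
  descents-π²-≤2 1≤d (inj₁ sorted) =
    descents-≤2 π² (pred n) (pred K) (pred (K + d)) λ i i<pn → boundary i (<pred⇒suc< i<pn)
    where
    boundary : ∀ i → suc i < n → π² (suc i) < π² i → i ≡ pred K ⊎ i ≡ pred (K + d)
    boundary i si<n desc with suc i ≟ K | suc i ≟ K + d | suc i ≟ c
    ... | yes si≡K | _           | _        = inj₁ (cong pred si≡K)
    ... | no _     | yes si≡K+d  | _        = inj₂ (cong pred si≡K+d)
    ... | no _     | no _        | yes si≡c = ⊥-elim (<-asym desc (prefixSorted⇒ascent 1≤d sorted si≡c))
    ... | no si≢K  | no si≢K+d   | no si≢c  = ⊥-elim (<-asym desc (π²-ascent si<n si≢c si≢K si≢K+d))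
  descents-π²-≤2 1≤d (inj₂ sorted) =
    descents-≤2 π² (pred n) (pred c) (pred K) λ i i<pn → boundary i (<pred⇒suc< i<pn)
    where
    boundary : ∀ i → suc i < n → π² (suc i) < π² i → i ≡ pred c ⊎ i ≡ pred K
    boundary i si<n desc with suc i ≟ c | suc i ≟ K | suc i ≟ K + d
    ... | yes si≡c | _        | _          = inj₁ (cong pred si≡c)
    ... | no _     | yes si≡K | _          = inj₂ (cong pred si≡K)
    ... | no _     | no _     | yes si≡K+d = ⊥-elim (<-asym desc (suffixSorted⇒ascent 1≤d sorted si≡K+d si<n))
    ... | no si≢c  | no si≢K  | no si≢K+d  = ⊥-elim (<-asym desc (π²-ascent si<n si≢c si≢K si≢K+d))

  descents-π²-≥3 : 1 ≤ d → ¬ PrefixSorted s → ¬ SuffixSorted s → 3 ≤ descents π² (pred n)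
  descents-π²-≥3 1≤d unsorted₁ unsorted₂ = descents-≥3 π²
    (pred-mono-< {{>-nonZero 0<c}} (c<K 1≤d))
    (pred-mono-< {{>-nonZero 0<K}} (m<m+n K 1≤d))
    (suc[m]≤n⇒m≤pred[n] (subst (_< n) (sym (suc-pred (K + d) {{>-nonZero 0<K+d}})) (¬suffixSorted⇒K+d<n unsorted₂)))
    (¬prefixSorted⇒descent 1≤d unsorted₁ (suc-pred c {{>-nonZero 0<c}}))
    (unsorted⇒descent unsorted₁ unsorted₂ (suc-pred K {{>-nonZero 0<K}}))
    (¬suffixSorted⇒descent 1≤d unsorted₂ (suc-pred (K + d) {{>-nonZero 0<K+d}}))
    where
    0<c : 0 < c
    0<c = ≤-<-trans z≤n (≤∧≢⇒< (rank-≤ true s c) unsorted₁)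
    0<K = <-trans 0<c (c<K 1≤d)
    0<K+d = <-≤-trans 0<K (m≤m+n K d)

-- Permutations with at most one descent

ascents⇒increasing : ∀ (f : ℕ → ℕ) lo hi → (∀ {x} → lo ≤ x → suc x < hi → f x < f (suc x)) →
                     ∀ {x y} → lo ≤ x → x < y → y < hi → f x < f y
ascents⇒increasing f lo hi ascent {x} {suc y} lo≤x x<1+y 1+y<hi with m≤n⇒m<n∨m≡n (s≤s⁻¹ x<1+y)
... | inj₂ refl = ascent lo≤x 1+y<hi
... | inj₁ x<y  = <-trans (ascents⇒increasing f lo hi ascent lo≤x x<y (<-trans (n<1+n y) 1+y<hi))
                    (ascent (≤-trans lo≤x (<⇒≤ x<y)) 1+y<hi)

rank-increasing : ∀ β s (f : ℕ → ℕ) lo hi →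
  (∀ {x y} → lo ≤ x → x < y → y < hi → f x < f y) →
  (∀ {y} → lo ≤ y → y < hi → f y < length s × bit s (f y) ≡ β) →
  (∀ {V} → V < length s → bit s V ≡ β → ∃ λ y → lo ≤ y × y < hi × f y ≡ V) →
  ∀ i → lo + i < hi → rank β s (f (lo + i)) ≡ i
rank-increasing β s f lo hi increasing hit only = go
  where
  increasing-≤ : ∀ {x y} → lo ≤ x → x ≤ y → y < hi → f x ≤ f y
  increasing-≤ lo≤x x≤y y<hi with m≤n⇒m<n∨m≡n x≤y
  ... | inj₁ x<y  = <⇒≤ (increasing lo≤x x<y y<hi)
  ... | inj₂ refl = ≤-refl

  go : ∀ i → lo + i < hi → rank β s (f (lo + i)) ≡ i
  go zero    lo<hi = rank-flat β s z≤n λ {V} _ V<f bitV≡β → case V<f bitV≡β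
    where
    case : ∀ {V} → V < f (lo + 0) → bit s V ≢ β
    case V<f bitV≡β with only (<-trans V<f (proj₁ (hit (m≤m+n lo 0) lo<hi))) bitV≡β
    ... | y , lo≤y , y<hi , refl =
      <⇒≱ V<f (increasing-≤ (m≤m+n lo 0) (subst (_≤ y) (sym (+-identityʳ lo)) lo≤y) y<hi)
  go (suc i) lo+1+i<hi = begin
    rank β s (f (lo + suc i))      ≡⟨ rank-flat β s (increasing (m≤m+n lo i) lo+i<lo+1+i lo+1+i<hi) gap ⟩
    rank β s (suc (f (lo + i)))    ≡⟨ rank-hit β s _ (proj₁ hitᵢ) (proj₂ hitᵢ) ⟩
    suc (rank β s (f (lo + i)))    ≡⟨ cong suc (go i lo+i<hi) ⟩
    suc i                          ∎
    where
    open ≡-Reasoning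
    lo+i<lo+1+i = subst (lo + i <_) (sym (+-suc lo i)) (n<1+n (lo + i))
    lo+i<hi = <-trans lo+i<lo+1+i lo+1+i<hi
    hitᵢ = hit (m≤m+n lo i) lo+i<hi
    gap : ∀ {V} → suc (f (lo + i)) ≤ V → V < f (lo + suc i) → bit s V ≢ β
    gap f<V V<f bitV≡β with only (<-trans V<f (proj₁ (hit (m≤m+n lo (suc i)) lo+1+i<hi))) bitV≡β
    ... | y , lo≤y , y<hi , refl with y ≤? lo + i
    ...   | yes y≤lo+i = <⇒≱ f<V (increasing-≤ lo≤y y≤lo+i lo+i<hi)
    ...   | no y≰lo+i  = <⇒≱ V<f (increasing-≤ (m≤m+n lo (suc i))
                           (subst (_≤ y) (sym (+-suc lo i)) (≰⇒> y≰lo+i)) y<hi)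

imageBits : ℕ → (ℕ → ℕ) → ℕ → List Bool
imageBits n f k = applyUpTo (λ V → does (anyUpTo? (λ x → f x ≟ V) k)) n

module _ (n : ℕ) (f : ℕ → ℕ)
         (f-< : ∀ {x} → x < n → f x < n)
         (f-injective : ∀ {x y} → x < n → y < n → f x ≡ f y → x ≡ y)
         (f-surjective : ∀ {V} → V < n → ∃ λ x → x < n × f x ≡ V)
         (k : ℕ) (k≤n : k ≤ n)
         (f-ascent : ∀ {x} → suc x < n → suc x ≢ k → f x < f (suc x)) where

  private
    S = imageBits n f k

    length-S : length S ≡ n
    length-S = length-applyUpTo _ n

    <n⇒<length : ∀ {V} → V < n → V < length S
    <n⇒<length = subst (_ <_) (sym length-S)

    bit-S : ∀ {V} → V < n → bit S V ≡ does (anyUpTo? (λ x → f x ≟ V) k)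
    bit-S = bit-applyUpTo _ n

    bit-true⇒image : ∀ {V} → V < n → bit S V ≡ true → ∃ λ x → x < k × f x ≡ V
    bit-true⇒image {V} V<n bit≡true with anyUpTo? (λ x → f x ≟ V) k | bit-S V<n
    ... | yes image | _        = image
    ... | no _      | bit≡false = ⊥-elim (false≢true (trans (sym bit≡false) bit≡true))
      where
      false≢true : false ≢ true
      false≢true ()

    image⇒bit-true : ∀ {x} → x < k → bit S (f x) ≡ true
    image⇒bit-true {x} x<k with anyUpTo? (λ y → f y ≟ f x) k | bit-S (f-< (<-≤-trans x<k k≤n))
    ... | yes _        | bit≡ = bit≡
    ... | no not-image | _    = ⊥-elim (not-image (x , x<k , refl))

    k≤x⇒bit-false : ∀ {x} → k ≤ x → x < n → bit S (f x) ≡ false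
    k≤x⇒bit-false {x} k≤x x<n with bit S (f x) in bit≡
    ... | false = refl
    ... | true with bit-true⇒image (f-< x<n) bit≡
    ...   | y , y<k , fy≡fx =
      ⊥-elim (<⇒≱ (<-≤-trans y<k k≤x) (≤-reflexive (sym (f-injective (<-≤-trans y<k k≤n) x<n fy≡fx))))

    bit-false⇒image : ∀ {V} → V < n → bit S V ≡ false → ∃ λ x → k ≤ x × x < n × f x ≡ V
    bit-false⇒image V<n bit≡false with f-surjective V<n
    ... | x , x<n , refl with x <? k
    ...   | no x≮k  = x , ≮⇒≥ x≮k , x<n , refl
    ...   | yes x<k with trans (sym (image⇒bit-true x<k)) bit≡false
    ...     | ()

    rank-true-f : ∀ {x} → x < k → rank true S (f x) ≡ x
    rank-true-f {x} x<k = rank-increasing true S f 0 k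
      (ascents⇒increasing f 0 k λ _ sx<k → f-ascent (<-≤-trans sx<k k≤n) (<⇒≢ sx<k))
      (λ _ y<k → <n⇒<length (f-< (<-≤-trans y<k k≤n)) , image⇒bit-true y<k)
      (λ V<len bit≡ → let y , y<k , fy≡V = bit-true⇒image (subst (_ <_) length-S V<len) bit≡
                       in y , z≤n , y<k , fy≡V)
      x x<k

    rank-false-f : ∀ {j} → k + j < n → rank false S (f (k + j)) ≡ j
    rank-false-f {j} k+j<n = rank-increasing false S f k n
      (ascents⇒increasing f k n λ {x} k≤x sx<n →
        f-ascent sx<n λ sx≡k → <-irrefl refl (subst (_≤ x) (sym sx≡k) k≤x))
      (λ k≤y y<n → <n⇒<length (f-< y<n) , k≤x⇒bit-false k≤y y<n)
      (λ V<len → bit-false⇒image (subst (_ <_) length-S V<len))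
      j k+j<n

    occ-true≡k : occ true S ≡ k
    occ-true≡k = ≤-antisym (≮⇒≥ k≮occ) (≤occ ≤-refl)
      where
      ≤occ : ∀ {m} → m ≤ k → m ≤ occ true S
      ≤occ {zero}  _   = z≤n
      ≤occ {suc i} i<k = subst (_< occ true S) (rank-true-f i<k)
        (rank<occ true S (f i) (<n⇒<length (f-< (<-≤-trans i<k k≤n))) (image⇒bit-true i<k))
      k≮occ : ¬ k < occ true S
      k≮occ k<occ with bit-true⇒image (subst (select true S k <_) length-S (select-<-length true S k k<occ))
                                       (bit-select true S k k<occ)
      ... | y , y<k , fy≡sel = <-irrefl (trans (sym (rank-true-f y<k))
                                  (trans (cong (rank true S) fy≡sel) (rank-select true S k k<occ))) y<k

  grassmannian-imageBits : ∀ {x} → x < n → grassmannian (imageBits n f k) x ≡ f x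
  grassmannian-imageBits {x} x<n with side k x
  ... | below x<k = begin
    grassmannian S x                   ≡⟨ grassmannian-below S (subst (x <_) (sym occ-true≡k) x<k) ⟩
    select true S x                    ≡⟨ cong (select true S) (rank-true-f x<k) ⟨
    select true S (rank true S (f x))  ≡⟨ select-rank true S (f x) (<n⇒<length (f-< x<n)) (image⇒bit-true x<k) ⟩
    f x                                ∎
    where open ≡-Reasoning
  ... | above j = begin
    grassmannian S (k + j)                     ≡⟨ cong (λ K → grassmannian S (K + j)) occ-true≡k ⟨
    grassmannian S (occ true S + j)            ≡⟨ grassmannian-above S j ⟩
    select false S j                           ≡⟨ cong (select false S) (rank-false-f x<n) ⟨
    select false S (rank false S (f (k + j)))  ≡⟨ select-rank false S (f (k + j)) (<n⇒<length (f-< x<n))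
                                                    (k≤x⇒bit-false (m≤m+n k j) x<n) ⟩
    f (k + j)                                  ∎
    where open ≡-Reasoning

grassmannianWord : (n : ℕ) → List Bool → Word n
grassmannianWord n s = fromFun n (grassmannian s)

identityWord : (n : ℕ) → Word n
identityWord n = fromFun n (λ x → x)

⟦grassmannianWord⟧ : ∀ {n s} → length s ≡ n → ∀ {x} → x < n → ⟦ grassmannianWord n s ⟧ x ≡ grassmannian s x
⟦grassmannianWord⟧ {s = s} refl x<n = ⟦fromFun⟧ _ (grassmannian s) x<n (grassmannian-< s x<n)

⟦identityWord⟧ : ∀ n {x} → x < n → ⟦ identityWord n ⟧ x ≡ x
⟦identityWord⟧ n x<n = ⟦fromFun⟧ n (λ x → x) x<n x<n

grassmannianWord-good : ∀ {n s} → length s ≡ n → 1 ≤ swapped s → PrefixSorted s ⊎ SuffixSorted s →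
                        Good (grassmannianWord n s)
grassmannianWord-good {n} {s} refl 1≤d sorted =
  ⟦⟧-injective⇒IsPerm w (λ x<n y<n e → grassmannian-injective s x<n y<n
    (trans (sym (⟦w⟧ x<n)) (trans e (⟦w⟧ y<n)))) ,
  subst (_≤ 1) (sym (des≡descents w (grassmannian s) (λ _ → ⟦w⟧))) (descents-grassmannian s) ,
  subst (_≤ 2) (sym (des≡descents (square w) (grassmannian s ∘ grassmannian s) ⟦square⟧≗π²))
    (descents-π²-≤2 s 1≤d sorted)
  where
  w = grassmannianWord n s
  ⟦w⟧ : ∀ {x} → x < n → ⟦ w ⟧ x ≡ grassmannian s x
  ⟦w⟧ = ⟦grassmannianWord⟧ {s = s} refl
  ⟦square⟧≗π² : ∀ x → x < n → ⟦ square w ⟧ x ≡ grassmannian s (grassmannian s x)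
  ⟦square⟧≗π² x x<n = trans (⟦square⟧ w x<n) (trans (⟦w⟧ (⟦⟧-< w x<n)) (cong (grassmannian s) (⟦w⟧ x<n)))

identityWord-good : ∀ n → Good (identityWord n)
identityWord-good n =
  ⟦⟧-injective⇒IsPerm w (λ x<n y<n e → trans (sym (⟦identityWord⟧ n x<n)) (trans e (⟦identityWord⟧ n y<n))) ,
  subst (_≤ 1) (sym (trans (des≡descents w (λ x → x) (λ _ → ⟦identityWord⟧ n)) no-descents)) z≤n ,
  subst (_≤ 2) (sym (trans (des≡descents (square w) (λ x → x) ⟦square⟧≗id) no-descents)) z≤n
  where
  w = identityWord n
  no-descents : descents (λ x → x) (pred n) ≡ 0
  no-descents = descents-≡0 (λ x → x) (pred n) (λ i _ → <-asym (n<1+n i))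
  ⟦square⟧≗id : ∀ x → x < n → ⟦ square w ⟧ x ≡ x
  ⟦square⟧≗id x x<n = trans (⟦square⟧ w x<n) (trans (⟦identityWord⟧ n (⟦⟧-< w x<n)) (⟦identityWord⟧ n x<n))

oneDescent⇒grassmannian : ∀ {n} (w : Word n) → IsPerm w → des w ≤ 1 →
  ∃ λ s → length s ≡ n × (∀ {x} → x < n → ⟦ w ⟧ x ≡ grassmannian s x)
oneDescent⇒grassmannian {n} w perm des≤1
  with descents-≤1⇒boundary ⟦ w ⟧ (pred n) (subst (_≤ 1) (des≡descents w ⟦ w ⟧ (λ _ _ → refl)) des≤1)
... | k , k≤pn , boundary = imageBits n ⟦ w ⟧ k , length-applyUpTo _ n , λ x<n →
  sym (grassmannian-imageBits n ⟦ w ⟧ (⟦⟧-< w) w-injective (IsPerm⇒⟦⟧-surjective w perm)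
    k (≤-trans k≤pn pred[n]≤n) ascent x<n)
  where
  w-injective = IsPerm⇒⟦⟧-injective w perm
  ascent : ∀ {x} → suc x < n → suc x ≢ k → ⟦ w ⟧ x < ⟦ w ⟧ (suc x)
  ascent {x} sx<n sx≢k with ⟦ w ⟧ (suc x) <? ⟦ w ⟧ x
  ... | yes desc  = ⊥-elim (sx≢k (boundary (suc[m]≤n⇒m≤pred[n] sx<n) desc))
  ... | no ¬desc = ≤∧≢⇒< (≮⇒≥ ¬desc) λ e → 1+n≢n (sym (w-injective (<-trans (n<1+n x) sx<n) sx<n e))

good⇒identity⊎grassmannian : ∀ {n} (w : Word n) → Good w →
  w ≡ identityWord n ⊎
  ∃ λ s → length s ≡ n × 1 ≤ swapped s × (PrefixSorted s ⊎ SuffixSorted s) × w ≡ grassmannianWord n s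
good⇒identity⊎grassmannian w (perm , des≤1 , des²≤2) with oneDescent⇒grassmannian w perm des≤1
... | s , refl , w≗π with swapped s ≟ 0
...   | yes d≡0 = inj₁ (⟦⟧-ext w _ λ x x<n →
          trans (w≗π x<n) (trans (swapped≡0⇒identity s d≡0 x<n) (sym (⟦identityWord⟧ _ x<n))))
...   | no d≢0  = inj₂ (s , refl , 1≤d , sorted , ⟦⟧-ext w _ λ x x<n →
          trans (w≗π x<n) (sym (⟦grassmannianWord⟧ {s = s} refl x<n)))
  where
  1≤d = n≢0⇒n>0 d≢0
  π² = grassmannian s ∘ grassmannian s
  descents-π²≤2 : descents π² (pred (length s)) ≤ 2
  descents-π²≤2 = subst (_≤ 2) (des≡descents (square w) π² λ x x<n →
    trans (⟦square⟧ w x<n) (trans (w≗π (⟦⟧-< w x<n)) (cong (grassmannian s) (w≗π x<n)))) des²≤2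
  sorted : PrefixSorted s ⊎ SuffixSorted s
  sorted with rank true s (rank true s (occ true s)) ≟ rank true s (occ true s)
            | rank true s (occ true s + swapped s) ≟ occ true s
  ... | yes sorted₁ | _           = inj₁ sorted₁
  ... | no _        | yes sorted₂ = inj₂ sorted₂
  ... | no ¬sorted₁ | no ¬sorted₂ = ⊥-elim (<⇒≱ (descents-π²-≥3 s 1≤d ¬sorted₁ ¬sorted₂) descents-π²≤2)

grassmannian-agree⇒bit-true : ∀ s s′ → occ true s ≡ occ true s′ →
  (∀ {x} → x < length s → grassmannian s x ≡ grassmannian s′ x) →
  ∀ {V} → V < length s → bit s V ≡ true → bit s′ V ≡ true
grassmannian-agree⇒bit-true s s′ K≡K′ π≗π′ {V} V<n bit≡true = begin
  bit s′ V                   ≡⟨ cong (bit s′) select′≡V ⟨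
  bit s′ (select true s′ i)  ≡⟨ bit-select true s′ i i<K′ ⟩
  true                       ∎
  where
  open ≡-Reasoning
  i = rank true s V
  i<K = rank<occ true s V V<n bit≡true
  i<K′ = subst (i <_) K≡K′ i<K
  select′≡V : select true s′ i ≡ V
  select′≡V = begin
    select true s′ i   ≡⟨ grassmannian-below s′ i<K′ ⟨
    grassmannian s′ i  ≡⟨ π≗π′ (<-≤-trans i<K (occ-true≤length s)) ⟨
    grassmannian s i   ≡⟨ grassmannian-below s i<K ⟩
    select true s i    ≡⟨ select-rank true s V V<n bit≡true ⟩
    V                  ∎

grassmannian-determines-bits : ∀ s s′ → length s ≡ length s′ → 1 ≤ swapped s → 1 ≤ swapped s′ →
  (∀ {x} → x < length s → grassmannian s x ≡ grassmannian s′ x) → s ≡ s′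
grassmannian-determines-bits s s′ len≡ 1≤d 1≤d′ π≗π′ = bits-ext s s′ len≡ same-bit
  where
  K≡K′ : occ true s ≡ occ true s′
  K≡K′ with grassmannian-descent s′ 1≤d′
  ... | q , sq≡K′ , sq<n′ , desc with suc q ≟ occ true s
  ...   | yes sq≡K = trans (sym sq≡K) sq≡K′
  ...   | no sq≢K  = ⊥-elim (<-asym desc (subst₂ _<_ (π≗π′ (<-trans (n<1+n q) sq<n)) (π≗π′ sq<n)
                       (grassmannian-ascent s sq<n sq≢K)))
    where sq<n = subst (suc q <_) (sym len≡) sq<n′
  π′≗π : ∀ {x} → x < length s′ → grassmannian s′ x ≡ grassmannian s x
  π′≗π x<n′ = sym (π≗π′ (subst (_ <_) (sym len≡) x<n′))
  same-bit : ∀ {V} → V < length s → bit s V ≡ bit s′ V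
  same-bit {V} V<n with bit s V in b | bit s′ V in b′
  ... | true  | true  = refl
  ... | false | false = refl
  ... | true  | false = trans (sym (grassmannian-agree⇒bit-true s s′ K≡K′ π≗π′ V<n b)) b′
  ... | false | true  = trans (sym b) (grassmannian-agree⇒bit-true s′ s (sym K≡K′) π′≗π (subst (V <_) len≡ V<n) b′)

identityWord≢grassmannianWord : ∀ {n s} → length s ≡ n → 1 ≤ swapped s → identityWord n ≢ grassmannianWord n s
identityWord≢grassmannianWord {n} {s} refl 1≤d id≡w with grassmannian-descent s 1≤d
... | q , _ , sq<n , desc = <-asym desc (subst₂ _<_ (π≡id q<n) (π≡id sq<n) (n<1+n q))
  where
  q<n = <-trans (n<1+n q) sq<n
  π≡id : ∀ {x} → x < n → x ≡ grassmannian s x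
  π≡id x<n = trans (sym (⟦identityWord⟧ n x<n))
    (trans (cong (λ w → ⟦ w ⟧ _) id≡w) (⟦grassmannianWord⟧ {s = s} refl x<n))

-- Splitting at the first block and enumerating

Sorted : List Bool → Set
Sorted u = rank true u (occ true u) ≡ occ true u

module _ (u v : List Bool) (balanced : occ false u ≡ occ true v) where
  private
    s = u ++ v

  occ-true-++ : occ true s ≡ length u
  occ-true-++ = trans (occ-++ true u v) (trans (cong (occ true u +_) (sym balanced)) (occ-true+occ-false u))

  swapped-++ : swapped s ≡ occ false u
  swapped-++ = trans (cong (rank false s) occ-true-++) (rank-++ˡ false u v ≤-refl)

  private
    c≡ : rank true s (occ true s) ≡ occ true u
    c≡ = trans (cong (rank true s) occ-true-++) (rank-++ˡ true u v ≤-refl)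

    K+d≡ : occ true s + swapped s ≡ length u + occ true v
    K+d≡ = cong₂ _+_ occ-true-++ (trans swapped-++ balanced)

    suffix-rank : rank true s (occ true s + swapped s) ≡ occ true u + rank true v (occ true v)
    suffix-rank = trans (cong (rank true s) K+d≡) (rank-++ʳ true u v (occ true v))

  prefixSorted-++ : PrefixSorted s ⇔ Sorted u
  prefixSorted-++ = mk⇔
    (λ sorted → trans (sym (rank-++ˡ true u v (occ-true≤length u)))
      (subst (λ c → rank true s c ≡ c) c≡ sorted))
    (λ sorted → subst (λ c → rank true s c ≡ c) (sym c≡) (trans (rank-++ˡ true u v (occ-true≤length u)) sorted))

  suffixSorted-++ : SuffixSorted s ⇔ Sorted v
  suffixSorted-++ = mk⇔
    (λ sorted → +-cancelˡ-≡ (occ true u) _ _ (trans (sym suffix-rank) (trans sorted (occ-++ true u v))))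
    (λ sorted → trans suffix-rank (trans (cong (occ true u +_) sorted) (sym (occ-++ true u v))))

module _ (s : List Bool) where
  private
    K = occ true s
    u = take K s
    v = drop K s

  take++drop-occ : u ++ v ≡ s
  take++drop-occ = take++drop≡id K s

  length-take-occ : length u ≡ K
  length-take-occ = trans (length-take K s) (m≤n⇒m⊓n≡m (occ-true≤length s))

  take-drop-balanced : occ false u ≡ occ true v
  take-drop-balanced = +-cancelˡ-≡ (occ true u) _ _ (begin
    occ true u + occ false u    ≡⟨ occ-true+occ-false u ⟩
    length u                    ≡⟨ length-take-occ ⟩
    K                           ≡⟨ cong (occ true) take++drop-occ ⟨
    occ true (u ++ v)           ≡⟨ occ-++ true u v ⟩
    occ true u + occ true v     ∎)
    where open ≡-Reasoning

concatMap-unique : ∀ {A B : Set} (f : A → List B) {xs} → Unique xs → (∀ x → Unique (f x)) →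
                   (∀ {x y} → x ≢ y → Disjoint (f x) (f y)) → Unique (concatMap f xs)
concatMap-unique f xs! f! disjoint =
  Unique.concat⁺ (All.tabulate λ {ys} ys∈ → let x , _ , ys≡fx = ∈-map⁻ f ys∈ in subst Unique (sym ys≡fx) (f! x))
    (AllPairs.map⁺ (AllPairs.map disjoint xs!))

map-unique : ∀ {A B : Set} (f : A → B) {xs} → Unique xs →
             (∀ {x y} → x ∈ xs → y ∈ xs → f x ≡ f y → x ≡ y) → Unique (map f xs)
map-unique f {[]}     []         _   = []
map-unique f {x ∷ xs} (x∉ ∷ xs!) inj = All.tabulate fresh ∷ map-unique f xs! (λ x∈ y∈ → inj (there x∈) (there y∈))
  where
  fresh : ∀ {z} → z ∈ map f xs → f x ≢ z
  fresh z∈ fx≡z with ∈-map⁻ f z∈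
  ... | y , y∈ , refl = All.lookup x∉ y∈ (inj (here refl) (there y∈) fx≡z)

++-injective : ∀ {A : Set} (u u′ : List A) {v v′} → length u ≡ length u′ → u ++ v ≡ u′ ++ v′ → u ≡ u′ × v ≡ v′
++-injective []      []        _     e    = refl , e
++-injective (x ∷ u) (x′ ∷ u′) |u|≡ e with ∷-injective e
... | refl , e′ = map₁ (cong (x ∷_)) (++-injective u u′ (suc-injective |u|≡) e′)

bitStrings : ℕ → List (List Bool)
bitStrings zero    = [] ∷ []
bitStrings (suc m) = map (true ∷_) (bitStrings m) ++ map (false ∷_) (bitStrings m)

∈-bitStrings⁺ : ∀ u → u ∈ bitStrings (length u)
∈-bitStrings⁺ []          = here refl
∈-bitStrings⁺ (true ∷ u)  = ∈-++⁺ˡ (∈-map⁺ (true ∷_) (∈-bitStrings⁺ u))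
∈-bitStrings⁺ (false ∷ u) = ∈-++⁺ʳ (map (true ∷_) _) (∈-map⁺ (false ∷_) (∈-bitStrings⁺ u))

∈-bitStrings⁻ : ∀ m {u} → u ∈ bitStrings m → length u ≡ m
∈-bitStrings⁻ zero    (here refl) = refl
∈-bitStrings⁻ (suc m) u∈ with ∈-++⁻ (map (true ∷_) (bitStrings m)) u∈
... | inj₁ u∈₁ with ∈-map⁻ (true ∷_) u∈₁
...   | u′ , u′∈ , refl = cong suc (∈-bitStrings⁻ m u′∈)
∈-bitStrings⁻ (suc m) u∈ | inj₂ u∈₂ with ∈-map⁻ (false ∷_) u∈₂
...   | u′ , u′∈ , refl = cong suc (∈-bitStrings⁻ m u′∈)

bitStrings-unique : ∀ m → Unique (bitStrings m)
bitStrings-unique zero    = All.[] ∷ []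
bitStrings-unique (suc m) = Unique.++⁺ (Unique.map⁺ ∷-injectiveʳ (bitStrings-unique m))
  (Unique.map⁺ ∷-injectiveʳ (bitStrings-unique m)) λ (u∈₁ , u∈₂) →
    let _ , _ , e₁ = ∈-map⁻ (true ∷_) u∈₁ ; _ , _ , e₂ = ∈-map⁻ (false ∷_) u∈₂ in
    true≢false (∷-injectiveˡ (trans (sym e₁) e₂))
  where
  true≢false : true ≢ false
  true≢false ()

∈-words : ∀ n m (v : Vec (Fin n) m) → v ∈ words n m
∈-words n zero    []      = here refl
∈-words n (suc m) (x ∷ v) = ∈-concatMap⁺ (λ y → map (y ∷_) (words n m))
  (lose (∈-allFin x) (∈-map⁺ (x ∷_) (∈-words n m v)))

words-unique : ∀ n m → Unique (words n m)
words-unique n zero    = All.[] ∷ []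
words-unique n (suc m) = concatMap-unique (λ x → map (x ∷_) (words n m)) (Unique.allFin⁺ n)
  (λ _ → Unique.map⁺ Vecₚ.∷-injectiveʳ (words-unique n m))
  λ x≢y (v∈₁ , v∈₂) → let _ , _ , e₁ = ∈-map⁻ _ v∈₁ ; _ , _ , e₂ = ∈-map⁻ _ v∈₂ in
    x≢y (Vecₚ.∷-injectiveˡ (trans (sym e₁) e₂))

-- The splits s = u ++ v at occ true s of the non-identity good permutations.
Admissible : List Bool → List Bool → Set
Admissible u v = (occ false u ≡ occ true v × 1 ≤ occ false u) × (Sorted u ⊎ Sorted v)

sorted? : ∀ u → Dec (Sorted u)
sorted? u = rank true u (occ true u) ≟ occ true u

admissible? : ∀ u v → Dec (Admissible u v)
admissible? u v = ((occ false u ≟ occ true v) ×-dec (1 ≤? occ false u)) ×-dec (sorted? u ⊎-dec sorted? v)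

splitsAt : ℕ → ℕ → List (List Bool × List Bool)
splitsAt n k = concatMap (λ u → map (u ,_) (filter (admissible? u) (bitStrings (n ∸ k)))) (bitStrings k)

splits : ℕ → List (List Bool × List Bool)
splits n = concatMap (splitsAt n) (upTo (suc n))

∈-splitsAt⁻ : ∀ {n k p} → p ∈ splitsAt n k →
              length (proj₁ p) ≡ k × length (proj₂ p) ≡ n ∸ k × Admissible (proj₁ p) (proj₂ p)
∈-splitsAt⁻ {n} {k} p∈ with find (∈-concatMap⁻ _ {xs = bitStrings k} p∈)
... | u , u∈ , p∈′ with ∈-map⁻ (u ,_) p∈′
...   | v , v∈ , refl with ∈-filter⁻ (admissible? u) {xs = bitStrings (n ∸ k)} v∈
...     | v∈bits , admissible = ∈-bitStrings⁻ k u∈ , ∈-bitStrings⁻ (n ∸ k) v∈bits , admissible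

∈-splits⁻ : ∀ {n u v} → (u , v) ∈ splits n → length u ≤ n × length v ≡ n ∸ length u × Admissible u v
∈-splits⁻ {n} p∈ with find (∈-concatMap⁻ (splitsAt n) {xs = upTo (suc n)} p∈)
... | k , k∈ , p∈′ with ∈-splitsAt⁻ {n} {k} p∈′
...   | refl , |v|≡ , admissible = s≤s⁻¹ (∈-upTo⁻ k∈) , |v|≡ , admissible

∈-splits⁺ : ∀ {n u v} → length u ≤ n → length v ≡ n ∸ length u → Admissible u v → (u , v) ∈ splits n
∈-splits⁺ {n} {u} {v} |u|≤n |v|≡ admissible = ∈-concatMap⁺ (splitsAt n) (lose (∈-upTo⁺ (s≤s |u|≤n))
  (∈-concatMap⁺ _ (lose (∈-bitStrings⁺ u) (∈-map⁺ (u ,_) (∈-filter⁺ (admissible? u)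
    (subst (λ m → v ∈ bitStrings m) |v|≡ (∈-bitStrings⁺ v)) admissible)))))

splits-unique : ∀ n → Unique (splits n)
splits-unique n = concatMap-unique (splitsAt n) (Unique.upTo⁺ (suc n)) splitsAt-unique
  λ k≢k′ (p∈ , p∈′) → k≢k′ (trans (sym (proj₁ (∈-splitsAt⁻ p∈))) (proj₁ (∈-splitsAt⁻ p∈′)))
  where
  splitsAt-unique : ∀ k → Unique (splitsAt n k)
  splitsAt-unique k = concatMap-unique _ (bitStrings-unique k)
    (λ u → Unique.map⁺ (cong proj₂) (Unique.filter⁺ (admissible? u) (bitStrings-unique (n ∸ k))))
    λ u≢u′ (p∈ , p∈′) → let _ , _ , e = ∈-map⁻ _ p∈ ; _ , _ , e′ = ∈-map⁻ _ p∈′ in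
      u≢u′ (cong proj₁ (trans (sym e) e′))

goodWords : (n : ℕ) → List (Word n)
goodWords n = identityWord n ∷ map (grassmannianWord n ∘ uncurry _++_) (splits n)

module _ {n : ℕ} where
  private
    f = grassmannianWord n ∘ uncurry _++_

    length-++≡ : ∀ {u v} → (u , v) ∈ splits n → length (u ++ v) ≡ n
    length-++≡ {u} {v} p∈ = let |u|≤n , |v|≡ , _ = ∈-splits⁻ {n} {u} {v} p∈ in
      trans (length-++ u) (trans (cong (length u +_) |v|≡) (m+[n∸m]≡n |u|≤n))

    occ-true≡length : ∀ {u v} → (u , v) ∈ splits n → occ true (u ++ v) ≡ length u
    occ-true≡length {u} {v} p∈ = let _ , _ , (balanced , _) , _ = ∈-splits⁻ {n} {u} {v} p∈ in
      occ-true-++ u v balanced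

    1≤swapped : ∀ {u v} → (u , v) ∈ splits n → 1 ≤ swapped (u ++ v)
    1≤swapped {u} {v} p∈ = let _ , _ , (balanced , 1≤d) , _ = ∈-splits⁻ {n} {u} {v} p∈ in
      subst (1 ≤_) (sym (swapped-++ u v balanced)) 1≤d

    splits⇒good : ∀ {u v} → (u , v) ∈ splits n → Good (grassmannianWord n (u ++ v))
    splits⇒good {u} {v} p∈ =
      let _ , _ , (balanced , _) , sorted = ∈-splits⁻ {n} {u} {v} p∈
      in grassmannianWord-good {n} {u ++ v} (length-++≡ p∈) (1≤swapped p∈)
           (Sum.map (Equivalence.from (prefixSorted-++ u v balanced))
                    (Equivalence.from (suffixSorted-++ u v balanced)) sorted)

  good⇒∈goodWords : ∀ {w : Word n} → Good w → w ∈ goodWords n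
  good⇒∈goodWords w-good with good⇒identity⊎grassmannian _ w-good
  ... | inj₁ w≡id = here w≡id
  ... | inj₂ (s , refl , 1≤d , sorted , w≡) = there (subst (_∈ _) (sym w≡′) (∈-map⁺ f uv∈))
    where
    u = take (occ true s) s
    v = drop (occ true s) s
    balanced = take-drop-balanced s
    s≡ = take++drop-occ s
    w≡′ = trans w≡ (cong (grassmannianWord _) (sym s≡))
    uv∈ : (u , v) ∈ splits (length s)
    uv∈ = ∈-splits⁺ {length s} {u} {v} (subst (_≤ length s) (sym (length-take-occ s)) (occ-true≤length s))
      (trans (length-drop (occ true s) s) (cong (length s ∸_) (sym (length-take-occ s))))
      ((balanced , subst (1 ≤_) (trans (cong swapped (sym s≡)) (swapped-++ u v balanced)) 1≤d) ,
       Sum.map (Equivalence.to (prefixSorted-++ u v balanced) ∘ subst PrefixSorted (sym s≡))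
               (Equivalence.to (suffixSorted-++ u v balanced) ∘ subst SuffixSorted (sym s≡)) sorted)

  ∈goodWords⇒good : ∀ {w : Word n} → w ∈ goodWords n → Good w
  ∈goodWords⇒good (here refl) = identityWord-good n
  ∈goodWords⇒good (there w∈) =
    let (u , v) , p∈ , w≡ = ∈-map⁻ f w∈ in subst Good (sym w≡) (splits⇒good {u} {v} p∈)

  goodWords-unique : Unique (goodWords n)
  goodWords-unique = All.tabulate identity-fresh ∷ map-unique f (splits-unique n) injective
    where
    identity-fresh : ∀ {w} → w ∈ map f (splits n) → identityWord n ≢ w
    identity-fresh w∈ id≡w = let (u , v) , p∈ , w≡ = ∈-map⁻ f w∈ in
      identityWord≢grassmannianWord {n} {u ++ v} (length-++≡ p∈) (1≤swapped p∈) (trans id≡w w≡)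
    injective : ∀ {p p′} → p ∈ splits n → p′ ∈ splits n → f p ≡ f p′ → p ≡ p′
    injective {u , v} {u′ , v′} p∈ p′∈ w≡w′ =
      let u≡u′ , v≡v′ = ++-injective u u′ |u|≡|u′| s≡s′ in cong₂ _,_ u≡u′ v≡v′
      where
      s≡s′ : u ++ v ≡ u′ ++ v′
      s≡s′ = grassmannian-determines-bits (u ++ v) (u′ ++ v′)
        (trans (length-++≡ p∈) (sym (length-++≡ p′∈))) (1≤swapped p∈) (1≤swapped p′∈)
        λ {x} x<len → let x<n = subst (x <_) (length-++≡ p∈) x<len in
          trans (sym (⟦grassmannianWord⟧ {s = u ++ v} (length-++≡ p∈) x<n))
            (trans (cong (λ w → ⟦ w ⟧ x) w≡w′) (⟦grassmannianWord⟧ {s = u′ ++ v′} (length-++≡ p′∈) x<n))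
      |u|≡|u′| : length u ≡ length u′
      |u|≡|u′| = trans (sym (occ-true≡length p∈)) (trans (cong (occ true) s≡s′) (occ-true≡length p′∈))

count≡suc-length-splits : ∀ n → count n ≡ suc (length (splits n))
count≡suc-length-splits n = trans
  (↭-length (∼bag⇒↭ (unique∧set⇒bag (Unique.filter⁺ good? (words-unique n n)) goodWords-unique
    (mk⇔ (λ w∈ → good⇒∈goodWords (proj₂ (∈-filter⁻ good? {xs = words n n} w∈)))
         (λ w∈ → ∈-filter⁺ good? (∈-words n n _) (∈goodWords⇒good w∈))))))
  (cong suc (length-map _ (splits n)))

-- Counting

𝟙 : Bool → ℕ
𝟙 true  = 1
𝟙 false = 0

𝟙-∧ : ∀ a b → 𝟙 (a ∧ b) ≡ 𝟙 a * 𝟙 b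
𝟙-∧ false b = refl
𝟙-∧ true  b = sym (+-identityʳ (𝟙 b))

𝟙-∧-swap : ∀ a b → 𝟙 (a ∧ b) ≡ 𝟙 b * 𝟙 a
𝟙-∧-swap a b = trans (𝟙-∧ a b) (*-comm (𝟙 a) (𝟙 b))

𝟙-∧-∨ : ∀ p x y → 𝟙 (p ∧ (x ∨ y)) + 𝟙 (p ∧ (x ∧ y)) ≡ 𝟙 (p ∧ x) + 𝟙 (p ∧ y)
𝟙-∧-∨ false x     y = refl
𝟙-∧-∨ true  false y = +-identityʳ (𝟙 y)
𝟙-∧-∨ true  true  y = refl

≡ᵇ-comm : ∀ m n → (m ≡ᵇ n) ≡ (n ≡ᵇ m)
≡ᵇ-comm zero    zero    = refl
≡ᵇ-comm zero    (suc n) = refl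
≡ᵇ-comm (suc m) zero    = refl
≡ᵇ-comm (suc m) (suc n) = ≡ᵇ-comm m n

≤ᵇ-suc : ∀ m n → (suc m ≤ᵇ suc n) ≡ (m ≤ᵇ n)
≤ᵇ-suc zero    n = refl
≤ᵇ-suc (suc m) n = refl

<⇒≡ᵇ-false : ∀ {m n} → m < n → (m ≡ᵇ n) ≡ false
<⇒≡ᵇ-false {zero}  {suc n} _         = refl
<⇒≡ᵇ-false {suc m} {suc n} (s≤s m<n) = <⇒≡ᵇ-false m<n

≤ᵇ-cong : ∀ {m n m′ n′} → (m ≤ n → m′ ≤ n′) → (m′ ≤ n′ → m ≤ n) → (m ≤ᵇ n) ≡ (m′ ≤ᵇ n′)
≤ᵇ-cong {m} {n} {m′} {n′} to from with m ≤? n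
... | yes m≤n = trans (dec-true (m ≤? n) m≤n) (sym (dec-true (m′ ≤? n′) (to m≤n)))
... | no m≰n  = trans (dec-false (m ≤? n) m≰n) (sym (dec-false (m′ ≤? n′) (m≰n ∘ from)))

sumTo : ℕ → (ℕ → ℕ) → ℕ
sumTo zero    f = f 0
sumTo (suc n) f = f 0 + sumTo n (f ∘ suc)

sumBits : ℕ → (List Bool → ℕ) → ℕ
sumBits zero    g = g []
sumBits (suc k) g = sumBits k (g ∘ (true ∷_)) + sumBits k (g ∘ (false ∷_))

sumTo-cong : ∀ n {f g} → (∀ i → i ≤ n → f i ≡ g i) → sumTo n f ≡ sumTo n g
sumTo-cong zero    f≗g = f≗g 0 z≤n
sumTo-cong (suc n) f≗g = cong₂ _+_ (f≗g 0 z≤n) (sumTo-cong n λ i i≤n → f≗g (suc i) (s≤s i≤n))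

sumTo-+ : ∀ n f g → sumTo n (λ i → f i + g i) ≡ sumTo n f + sumTo n g
sumTo-+ zero    f g = refl
sumTo-+ (suc n) f g = trans (cong (f 0 + g 0 +_) (sumTo-+ n (f ∘ suc) (g ∘ suc))) (interchange (f 0) (g 0) _ _)

sumTo-suc : ∀ n f → sumTo (suc n) f ≡ sumTo n f + f (suc n)
sumTo-suc zero    f = refl
sumTo-suc (suc n) f = trans (cong (f 0 +_) (sumTo-suc n (f ∘ suc))) (sym (+-assoc (f 0) _ _))

sumTo-reverse : ∀ n f → sumTo n (λ i → f (n ∸ i)) ≡ sumTo n f
sumTo-reverse zero    f = refl
sumTo-reverse (suc n) f = trans (cong (f (suc n) +_) (sumTo-reverse n f))
  (trans (+-comm (f (suc n)) _) (sym (sumTo-suc n f)))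

sumTo-const : ∀ n c → sumTo n (λ _ → c) ≡ suc n * c
sumTo-const zero    c = sym (+-identityʳ c)
sumTo-const (suc n) c = cong (c +_) (sumTo-const n c)

sumBits-cong : ∀ k {g h} → (∀ u → g u ≡ h u) → sumBits k g ≡ sumBits k h
sumBits-cong zero    g≗h = g≗h []
sumBits-cong (suc k) g≗h = cong₂ _+_ (sumBits-cong k (g≗h ∘ (true ∷_))) (sumBits-cong k (g≗h ∘ (false ∷_)))

sumBits-+ : ∀ k g h → sumBits k (λ u → g u + h u) ≡ sumBits k g + sumBits k h
sumBits-+ zero    g h = refl
sumBits-+ (suc k) g h = trans (cong₂ _+_ (sumBits-+ k (g ∘ (true ∷_)) (h ∘ (true ∷_)))
  (sumBits-+ k (g ∘ (false ∷_)) (h ∘ (false ∷_))))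
  (interchange (sumBits k (g ∘ (true ∷_))) (sumBits k (h ∘ (true ∷_))) _ _)

sumBits-zero : ∀ k → sumBits k (λ _ → 0) ≡ 0
sumBits-zero zero    = refl
sumBits-zero (suc k) = cong₂ _+_ (sumBits-zero k) (sumBits-zero k)

sumBits-comm : ∀ k m (g : List Bool → List Bool → ℕ) →
               sumBits k (λ u → sumBits m (g u)) ≡ sumBits m (λ v → sumBits k (λ u → g u v))
sumBits-comm zero    m g = refl
sumBits-comm (suc k) m g = trans (cong₂ _+_ (sumBits-comm k m (g ∘ (true ∷_))) (sumBits-comm k m (g ∘ (false ∷_))))
  (sym (sumBits-+ m _ _))

length-filter-𝟙 : ∀ {A : Set} {P : A → Set} (P? : Decidable P) xs →
                  length (filter P? xs) ≡ sum (map (𝟙 ∘ does ∘ P?) xs)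
length-filter-𝟙 P? []       = refl
length-filter-𝟙 P? (x ∷ xs) with does (P? x)
... | true  = cong suc (length-filter-𝟙 P? xs)
... | false = length-filter-𝟙 P? xs

length-concatMap : ∀ {A B : Set} (f : A → List B) xs → length (concatMap f xs) ≡ sum (map (length ∘ f) xs)
length-concatMap f []       = refl
length-concatMap f (x ∷ xs) = trans (length-++ (f x)) (cong (length (f x) +_) (length-concatMap f xs))

sum-map-bitStrings : ∀ k g → sum (map g (bitStrings k)) ≡ sumBits k g
sum-map-bitStrings zero    g = +-identityʳ (g [])
sum-map-bitStrings (suc k) g = begin
  sum (map g (map (true ∷_) B ++ map (false ∷_) B))              ≡⟨ cong sum (map-++ g (map (true ∷_) B) _) ⟩
  sum (map g (map (true ∷_) B) ++ map g (map (false ∷_) B))      ≡⟨ sum-++ (map g (map (true ∷_) B)) _ ⟩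
  sum (map g (map (true ∷_) B)) + sum (map g (map (false ∷_) B)) ≡⟨ cong₂ _+_ (cong sum (map-∘ B)) (cong sum (map-∘ B)) ⟨
  sum (map (g ∘ (true ∷_)) B) + sum (map (g ∘ (false ∷_)) B)     ≡⟨ cong₂ _+_ (sum-map-bitStrings k _) (sum-map-bitStrings k _) ⟩
  sumBits (suc k) g                                              ∎
  where
  open ≡-Reasoning
  B = bitStrings k

sum-map-applyUpTo : ∀ {A : Set} n (g : A → ℕ) h → sum (map g (applyUpTo h (suc n))) ≡ sumTo n (g ∘ h)
sum-map-applyUpTo zero    g h = +-identityʳ (g (h 0))
sum-map-applyUpTo (suc n) g h = cong (g (h 0) +_) (sum-map-applyUpTo n g (h ∘ suc))

#admissible : ℕ → ℕ → ℕ
#admissible k m = sumBits k λ u → sumBits m λ v → 𝟙 (does (admissible? u v))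

length-splits : ∀ n → length (splits n) ≡ sumTo n (λ k → #admissible k (n ∸ k))
length-splits n = begin
  length (splits n)                                  ≡⟨ length-concatMap (splitsAt n) (upTo (suc n)) ⟩
  sum (map (length ∘ splitsAt n) (upTo (suc n)))     ≡⟨ sum-map-applyUpTo n (length ∘ splitsAt n) (λ k → k) ⟩
  sumTo n (length ∘ splitsAt n)                      ≡⟨ sumTo-cong n (λ k _ → length-splitsAt k) ⟩
  sumTo n (λ k → #admissible k (n ∸ k))              ∎
  where
  open ≡-Reasoning
  length-splitsAt : ∀ k → length (splitsAt n k) ≡ #admissible k (n ∸ k)
  length-splitsAt k = trans (length-concatMap (λ u → map (u ,_) (filter (admissible? u) (bitStrings (n ∸ k))))
    (bitStrings k)) (trans (sum-map-bitStrings k _)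
    (sumBits-cong k λ u → trans (length-map (u ,_) (filter (admissible? u) (bitStrings (n ∸ k))))
      (trans (length-filter-𝟙 (admissible? u) (bitStrings (n ∸ k))) (sum-map-bitStrings (n ∸ k) _))))

sortedᵇ : List Bool → Bool
sortedᵇ u = does (sorted? u)

sortedᵇ-false∷ : ∀ u → sortedᵇ (false ∷ u) ≡ (occ true u ≡ᵇ 0)
sortedᵇ-false∷ u with occ true u in t≡
... | zero  = refl
... | suc t = <⇒≡ᵇ-false (s≤s (rank-≤ true u t))

sumBits-noTrue : ∀ k (g : ℕ → ℕ) → sumBits k (λ u → 𝟙 (occ true u ≡ᵇ 0) * g (occ false u)) ≡ g k
sumBits-noTrue zero    g = +-identityʳ (g 0)
sumBits-noTrue (suc k) g = cong₂ _+_ (sumBits-zero k) (sumBits-noTrue k (g ∘ suc))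

sumBits-noFalse : ∀ k (g : ℕ → ℕ) → sumBits k (λ u → 𝟙 (occ false u ≡ᵇ 0) * g (occ true u)) ≡ g k
sumBits-noFalse zero    g = +-identityʳ (g 0)
sumBits-noFalse (suc k) g = trans (cong₂ _+_ (sumBits-noFalse k (g ∘ suc)) (sumBits-zero k)) (+-identityʳ _)

sumBits-none : ∀ β k → sumBits k (λ u → 𝟙 (occ β u ≡ᵇ 0)) ≡ 1
sumBits-none true  k = trans (sumBits-cong k (λ u → sym (*-identityʳ _))) (sumBits-noTrue k (λ _ → 1))
sumBits-none false k = trans (sumBits-cong k (λ u → sym (*-identityʳ _))) (sumBits-noFalse k (λ _ → 1))

sumBits-sorted-false : ∀ k h → sumBits k (λ u → 𝟙 (sortedᵇ u) * h (occ false u)) ≡ sumTo k h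
sumBits-sorted-false zero    h = +-identityʳ (h 0)
sumBits-sorted-false (suc k) h = begin
  sumBits k (λ u → 𝟙 (sortedᵇ u) * h (occ false u)) + sumBits k (λ u → 𝟙 (sortedᵇ (false ∷ u)) * h (suc (occ false u)))
    ≡⟨ cong₂ _+_ (sumBits-sorted-false k h)
         (sumBits-cong k λ u → cong (λ b → 𝟙 b * h (suc (occ false u))) (sortedᵇ-false∷ u)) ⟩
  sumTo k h + sumBits k (λ u → 𝟙 (occ true u ≡ᵇ 0) * h (suc (occ false u)))
    ≡⟨ cong (sumTo k h +_) (sumBits-noTrue k (h ∘ suc)) ⟩
  sumTo k h + h (suc k)
    ≡⟨ sumTo-suc k h ⟨
  sumTo (suc k) h ∎
  where open ≡-Reasoning

sumBits-sorted-true : ∀ k h → sumBits k (λ v → 𝟙 (sortedᵇ v) * h (occ true v)) ≡ sumTo k h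
sumBits-sorted-true zero    h = +-identityʳ (h 0)
sumBits-sorted-true (suc k) h = begin
  sumBits k (λ v → 𝟙 (sortedᵇ v) * h (suc (occ true v))) + sumBits k (λ v → 𝟙 (sortedᵇ (false ∷ v)) * h (occ true v))
    ≡⟨ cong₂ _+_ (sumBits-sorted-true k (h ∘ suc)) (sumBits-cong k only-h0) ⟩
  sumTo k (h ∘ suc) + sumBits k (λ v → 𝟙 (occ true v ≡ᵇ 0) * h 0)
    ≡⟨ cong (sumTo k (h ∘ suc) +_) (sumBits-noTrue k (λ _ → h 0)) ⟩
  sumTo k (h ∘ suc) + h 0
    ≡⟨ +-comm _ (h 0) ⟩
  sumTo (suc k) h ∎
  where
  open ≡-Reasoning
  only-h0 : ∀ v → 𝟙 (sortedᵇ (false ∷ v)) * h (occ true v) ≡ 𝟙 (occ true v ≡ᵇ 0) * h 0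
  only-h0 v rewrite sortedᵇ-false∷ v with occ true v
  ... | zero  = refl
  ... | suc _ = refl

sumTo-≡ᵇ : ∀ m z (c : ℕ → Bool) → sumTo m (λ e → 𝟙 ((e ≡ᵇ z) ∧ c e)) ≡ 𝟙 ((z ≤ᵇ m) ∧ c z)
sumTo-≡ᵇ zero    zero    c = refl
sumTo-≡ᵇ zero    (suc z) c = refl
sumTo-≡ᵇ (suc m) zero    c = trans (cong (𝟙 (c 0) +_) (trans (sumTo-const m 0) (*-zeroʳ (suc m)))) (+-identityʳ _)
sumTo-≡ᵇ (suc m) (suc z) c = trans (sumTo-≡ᵇ m z (c ∘ suc)) (cong (λ b → 𝟙 (b ∧ c (suc z))) (sym (≤ᵇ-suc z m)))

sumTo-⊓ : ∀ k m → sumTo k (λ d → 𝟙 ((d ≤ᵇ m) ∧ (1 ≤ᵇ d))) ≡ k ⊓ m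
sumTo-⊓ zero    m = refl
sumTo-⊓ (suc k) m = trans (sumTo-suc k _) (trans (cong₂ _+_ (sumTo-⊓ k m) (cong 𝟙 (∧-identityʳ (suc k ≤ᵇ m)))) (step k m))
  where
  step : ∀ k m → k ⊓ m + 𝟙 (suc k ≤ᵇ m) ≡ suc k ⊓ m
  step zero    zero    = refl
  step (suc k) zero    = refl
  step zero    (suc m) = refl
  step (suc k) (suc m) = cong suc (trans (cong (k ⊓ m +_) (cong 𝟙 (≤ᵇ-suc (suc k) m))) (step k m))

sumBits-sorted-true-≡ᵇ : ∀ m z c → sumBits m (λ v → 𝟙 (((z ≡ᵇ occ true v) ∧ c) ∧ sortedᵇ v)) ≡ 𝟙 ((z ≤ᵇ m) ∧ c)
sumBits-sorted-true-≡ᵇ m z c = begin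
  sumBits m (λ v → 𝟙 (((z ≡ᵇ occ true v) ∧ c) ∧ sortedᵇ v))   ≡⟨ sumBits-cong m (λ v → 𝟙-∧-swap _ (sortedᵇ v)) ⟩
  sumBits m (λ v → 𝟙 (sortedᵇ v) * 𝟙 ((z ≡ᵇ occ true v) ∧ c)) ≡⟨ sumBits-sorted-true m (λ e → 𝟙 ((z ≡ᵇ e) ∧ c)) ⟩
  sumTo m (λ e → 𝟙 ((z ≡ᵇ e) ∧ c))                            ≡⟨ sumTo-cong m (λ e _ → cong (λ b → 𝟙 (b ∧ c)) (≡ᵇ-comm z e)) ⟩
  sumTo m (λ e → 𝟙 ((e ≡ᵇ z) ∧ c))                            ≡⟨ sumTo-≡ᵇ m z (λ _ → c) ⟩
  𝟙 ((z ≤ᵇ m) ∧ c)                                            ∎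
  where open ≡-Reasoning

sumBits-sorted-false-≡ᵇ : ∀ k z (c : ℕ → Bool) →
  sumBits k (λ u → 𝟙 (((occ false u ≡ᵇ z) ∧ c (occ false u)) ∧ sortedᵇ u)) ≡ 𝟙 ((z ≤ᵇ k) ∧ c z)
sumBits-sorted-false-≡ᵇ k z c = begin
  sumBits k (λ u → 𝟙 (((occ false u ≡ᵇ z) ∧ c (occ false u)) ∧ sortedᵇ u))
    ≡⟨ sumBits-cong k (λ u → 𝟙-∧-swap _ (sortedᵇ u)) ⟩
  sumBits k (λ u → 𝟙 (sortedᵇ u) * 𝟙 ((occ false u ≡ᵇ z) ∧ c (occ false u)))
    ≡⟨ sumBits-sorted-false k (λ d → 𝟙 ((d ≡ᵇ z) ∧ c d)) ⟩
  sumTo k (λ d → 𝟙 ((d ≡ᵇ z) ∧ c d))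
    ≡⟨ sumTo-≡ᵇ k z c ⟩
  𝟙 ((z ≤ᵇ k) ∧ c z) ∎
  where open ≡-Reasoning

#positive≤ : Bool → ℕ → ℕ → ℕ
#positive≤ β k m = sumBits k λ u → 𝟙 ((occ β u ≤ᵇ m) ∧ (1 ≤ᵇ occ β u))

-- Inclusion–exclusion on whether u or v is sorted; both are for exactly k ⊓ m pairs.
#admissible+⊓ : ∀ k m → #admissible k m + k ⊓ m ≡ #positive≤ true m k + #positive≤ false k m
#admissible+⊓ k m = begin
  Σ² (λ u v → 𝟙 (p u v ∧ (sortedᵇ u ∨ sortedᵇ v))) + k ⊓ m
    ≡⟨ cong (#admissible k m +_) both-sorted ⟨
  Σ² (λ u v → 𝟙 (p u v ∧ (sortedᵇ u ∨ sortedᵇ v))) + Σ² (λ u v → 𝟙 (p u v ∧ (sortedᵇ u ∧ sortedᵇ v)))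
    ≡⟨ Σ²-+ _ _ ⟨
  Σ² (λ u v → 𝟙 (p u v ∧ (sortedᵇ u ∨ sortedᵇ v)) + 𝟙 (p u v ∧ (sortedᵇ u ∧ sortedᵇ v)))
    ≡⟨ sumBits-cong k (λ u → sumBits-cong m λ v → 𝟙-∧-∨ (p u v) (sortedᵇ u) (sortedᵇ v)) ⟩
  Σ² (λ u v → 𝟙 (p u v ∧ sortedᵇ u) + 𝟙 (p u v ∧ sortedᵇ v))
    ≡⟨ Σ²-+ _ _ ⟩
  Σ² (λ u v → 𝟙 (p u v ∧ sortedᵇ u)) + Σ² (λ u v → 𝟙 (p u v ∧ sortedᵇ v))
    ≡⟨ cong₂ _+_ prefix-sorted suffix-sorted ⟩
  #positive≤ true m k + #positive≤ false k m ∎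
  where
  open ≡-Reasoning
  p : List Bool → List Bool → Bool
  p u v = (occ false u ≡ᵇ occ true v) ∧ (1 ≤ᵇ occ false u)
  Σ² : (List Bool → List Bool → ℕ) → ℕ
  Σ² g = sumBits k λ u → sumBits m (g u)
  Σ²-+ : ∀ g h → Σ² (λ u v → g u v + h u v) ≡ Σ² g + Σ² h
  Σ²-+ g h = trans (sumBits-cong k λ u → sumBits-+ m (g u) (h u)) (sumBits-+ k _ _)
  both-sorted : Σ² (λ u v → 𝟙 (p u v ∧ (sortedᵇ u ∧ sortedᵇ v))) ≡ k ⊓ m
  both-sorted = begin
    Σ² (λ u v → 𝟙 (p u v ∧ (sortedᵇ u ∧ sortedᵇ v)))
      ≡⟨ sumBits-cong k (λ u → sumBits-cong m λ v → cong 𝟙 (reassociate (occ false u ≡ᵇ occ true v) _ _ _)) ⟩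
    Σ² (λ u v → 𝟙 (((occ false u ≡ᵇ occ true v) ∧ ((1 ≤ᵇ occ false u) ∧ sortedᵇ u)) ∧ sortedᵇ v))
      ≡⟨ sumBits-cong k (λ u → sumBits-sorted-true-≡ᵇ m (occ false u) _) ⟩
    sumBits k (λ u → 𝟙 ((occ false u ≤ᵇ m) ∧ ((1 ≤ᵇ occ false u) ∧ sortedᵇ u)))
      ≡⟨ sumBits-cong k (λ u → trans (cong 𝟙 (sym (∧-assoc (occ false u ≤ᵇ m) (1 ≤ᵇ occ false u) (sortedᵇ u))))
                                  (𝟙-∧-swap _ (sortedᵇ u))) ⟩
    sumBits k (λ u → 𝟙 (sortedᵇ u) * 𝟙 ((occ false u ≤ᵇ m) ∧ (1 ≤ᵇ occ false u)))
      ≡⟨ sumBits-sorted-false k (λ d → 𝟙 ((d ≤ᵇ m) ∧ (1 ≤ᵇ d))) ⟩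
    sumTo k (λ d → 𝟙 ((d ≤ᵇ m) ∧ (1 ≤ᵇ d)))
      ≡⟨ sumTo-⊓ k m ⟩
    k ⊓ m ∎
    where
    reassociate : ∀ a b x y → (a ∧ b) ∧ (x ∧ y) ≡ (a ∧ (b ∧ x)) ∧ y
    reassociate a b x y = trans (sym (∧-assoc (a ∧ b) x y)) (cong (_∧ y) (∧-assoc a b x))
  prefix-sorted : Σ² (λ u v → 𝟙 (p u v ∧ sortedᵇ u)) ≡ #positive≤ true m k
  prefix-sorted = trans (sumBits-comm k m _)
    (sumBits-cong m λ v → sumBits-sorted-false-≡ᵇ k (occ true v) (1 ≤ᵇ_))
  suffix-sorted : Σ² (λ u v → 𝟙 (p u v ∧ sortedᵇ v)) ≡ #positive≤ false k m
  suffix-sorted = sumBits-cong k λ u → sumBits-sorted-true-≡ᵇ m (occ false u) _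

positiveSum : Bool → ℕ → ℕ
positiveSum β n = sumTo n λ k → #positive≤ β k (n ∸ k)

length-splits+⊓ : ∀ n → length (splits n) + sumTo n (λ k → k ⊓ (n ∸ k)) ≡ positiveSum true n + positiveSum false n
length-splits+⊓ n = begin
  length (splits n) + sumTo n (λ k → k ⊓ (n ∸ k))
    ≡⟨ cong (_+ sumTo n (λ k → k ⊓ (n ∸ k))) (length-splits n) ⟩
  sumTo n (λ k → #admissible k (n ∸ k)) + sumTo n (λ k → k ⊓ (n ∸ k))
    ≡⟨ sumTo-+ n _ _ ⟨
  sumTo n (λ k → #admissible k (n ∸ k) + k ⊓ (n ∸ k))
    ≡⟨ sumTo-cong n (λ k _ → #admissible+⊓ k (n ∸ k)) ⟩
  sumTo n (λ k → #positive≤ true (n ∸ k) k + #positive≤ false k (n ∸ k))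
    ≡⟨ sumTo-+ n _ _ ⟩
  sumTo n (λ k → #positive≤ true (n ∸ k) k) + positiveSum false n
    ≡⟨ cong (_+ positiveSum false n) reindex ⟩
  positiveSum true n + positiveSum false n ∎
  where
  open ≡-Reasoning
  reindex : sumTo n (λ k → #positive≤ true (n ∸ k) k) ≡ positiveSum true n
  reindex = trans (sumTo-cong n λ k k≤n → cong (#positive≤ true (n ∸ k)) (sym (m∸[m∸n]≡n k≤n)))
    (sumTo-reverse n λ j → #positive≤ true j (n ∸ j))

fibTerm : Bool → ℕ → ℕ → ℕ
fibTerm β n k = sumBits k λ u → 𝟙 (k + occ β u ≤ᵇ n)

fibCount : Bool → ℕ → ℕ
fibCount β n = sumTo n (fibTerm β n)

positiveSum+suc : ∀ β n → positiveSum β n + suc n ≡ fibCount β n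
positiveSum+suc β n = begin
  positiveSum β n + suc n
    ≡⟨ cong (positiveSum β n +_) (trans (sym (*-identityʳ (suc n))) (sym (sumTo-const n 1))) ⟩
  positiveSum β n + sumTo n (λ _ → 1)
    ≡⟨ sumTo-+ n _ _ ⟨
  sumTo n (λ k → #positive≤ β k (n ∸ k) + 1)
    ≡⟨ sumTo-cong n pointwise ⟩
  fibCount β n ∎
  where
  open ≡-Reasoning
  split : ∀ k → k ≤ n → ∀ t → 𝟙 ((t ≤ᵇ n ∸ k) ∧ (1 ≤ᵇ t)) + 𝟙 (t ≡ᵇ 0) ≡ 𝟙 (k + t ≤ᵇ n)
  split k k≤n zero    = cong 𝟙 (sym (dec-true (k + 0 ≤? n) (subst (_≤ n) (sym (+-identityʳ k)) k≤n)))
  split k k≤n (suc t) = trans (+-identityʳ _) (cong 𝟙 (trans (∧-identityʳ _) (≤ᵇ-cong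
    (λ 1+t≤n∸k → subst (k + suc t ≤_) (m+[n∸m]≡n k≤n) (+-monoʳ-≤ k 1+t≤n∸k))
    (λ k+1+t≤n → subst (_≤ n ∸ k) (m+n∸m≡n k (suc t)) (∸-monoˡ-≤ k k+1+t≤n)))))
  pointwise : ∀ k → k ≤ n → #positive≤ β k (n ∸ k) + 1 ≡ sumBits k (λ u → 𝟙 (k + occ β u ≤ᵇ n))
  pointwise k k≤n = trans (cong (#positive≤ β k (n ∸ k) +_) (sym (sumBits-none β k)))
    (trans (sym (sumBits-+ k _ _)) (sumBits-cong k λ u → split k k≤n (occ β u)))

fibTerm-suc : ∀ β n k → fibTerm β (suc (suc n)) (suc k) ≡ fibTerm β (suc n) k + fibTerm β n k
fibTerm-suc true  n k = trans (cong₂ _+_ (sumBits-cong k λ u → cong 𝟙 (drop-two (occ true u)))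
                                         (sumBits-cong k λ u → cong 𝟙 (drop-one (occ true u))))
                              (+-comm (fibTerm true n k) _)
  where
  drop-one : ∀ t → (suc k + t ≤ᵇ suc (suc n)) ≡ (k + t ≤ᵇ suc n)
  drop-one t = ≤ᵇ-suc (k + t) (suc n)
  drop-two : ∀ t → (suc k + suc t ≤ᵇ suc (suc n)) ≡ (k + t ≤ᵇ n)
  drop-two t = trans (drop-one (suc t)) (trans (cong (_≤ᵇ suc n) (+-suc k t)) (≤ᵇ-suc (k + t) n))
fibTerm-suc false n k = cong₂ _+_ (sumBits-cong k λ u → cong 𝟙 (drop-one (occ false u)))
                                  (sumBits-cong k λ u → cong 𝟙 (drop-two (occ false u)))
  where
  drop-one : ∀ t → (suc k + t ≤ᵇ suc (suc n)) ≡ (k + t ≤ᵇ suc n)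
  drop-one t = ≤ᵇ-suc (k + t) (suc n)
  drop-two : ∀ t → (suc k + suc t ≤ᵇ suc (suc n)) ≡ (k + t ≤ᵇ n)
  drop-two t = trans (drop-one (suc t)) (trans (cong (_≤ᵇ suc n) (+-suc k t)) (≤ᵇ-suc (k + t) n))

fibTerm-beyond : ∀ β n → fibTerm β n (suc n) ≡ 0
fibTerm-beyond β n = trans (sumBits-cong (suc n) λ u → cong 𝟙 (dec-false (suc n + occ β u ≤? n)
  λ le → <-irrefl refl (≤-trans (s≤s (m≤m+n n (occ β u))) le))) (sumBits-zero (suc n))

fibCount-suc-suc : ∀ β n → fibCount β (suc (suc n)) ≡ suc (fibCount β (suc n) + fibCount β n)
fibCount-suc-suc β n = cong suc (begin
  sumTo (suc n) (fibTerm β (suc (suc n)) ∘ suc)                       ≡⟨ sumTo-cong (suc n) (λ k _ → fibTerm-suc β n k) ⟩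
  sumTo (suc n) (λ k → fibTerm β (suc n) k + fibTerm β n k)            ≡⟨ sumTo-+ (suc n) (fibTerm β (suc n)) (fibTerm β n) ⟩
  fibCount β (suc n) + sumTo (suc n) (fibTerm β n)                     ≡⟨ cong (fibCount β (suc n) +_) (sumTo-suc n _) ⟩
  fibCount β (suc n) + (fibCount β n + fibTerm β n (suc n))            ≡⟨ cong (λ t → fibCount β (suc n) + (fibCount β n + t)) (fibTerm-beyond β n) ⟩
  fibCount β (suc n) + (fibCount β n + 0)                              ≡⟨ cong (fibCount β (suc n) +_) (+-identityʳ _) ⟩
  fibCount β (suc n) + fibCount β n                                    ∎)
  where open ≡-Reasoning

fibCount+1≡F : ∀ β n → fibCount β n + 1 ≡ F (n + 3)
fibCount+1≡F β     zero          = refl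
fibCount+1≡F true  (suc zero)    = refl
fibCount+1≡F false (suc zero)    = refl
fibCount+1≡F β     (suc (suc n)) = begin
  fibCount β (suc (suc n)) + 1                        ≡⟨ cong (_+ 1) (fibCount-suc-suc β n) ⟩
  suc (fibCount β (suc n) + fibCount β n) + 1         ≡⟨ rearrange (fibCount β n) (fibCount β (suc n)) ⟩
  (fibCount β n + 1) + (fibCount β (suc n) + 1)       ≡⟨ cong₂ _+_ (fibCount+1≡F β n) (fibCount+1≡F β (suc n)) ⟩
  F (n + 3) + F (suc n + 3)                           ∎
  where
  open ≡-Reasoning
  rearrange : ∀ a b → suc (b + a) + 1 ≡ (a + 1) + (b + 1)
  rearrange a b = solve 2 (λ a b → (con 1 :+ (b :+ a)) :+ con 1 := (a :+ con 1) :+ (b :+ con 1)) refl a b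
    where open +-*-Solver

minSum : ℕ → ℕ
minSum n = sumTo n λ k → k ⊓ (n ∸ k)

minSum-suc-suc : ∀ n → minSum (suc (suc n)) ≡ minSum n + suc n
minSum-suc-suc n = begin
  sumTo (suc n) (λ k → suc k ⊓ (suc n ∸ k))
    ≡⟨ sumTo-suc n _ ⟩
  sumTo n (λ k → suc k ⊓ (suc n ∸ k)) + suc (suc n) ⊓ (suc n ∸ suc n)
    ≡⟨ cong₂ _+_ (sumTo-cong n λ k k≤n → cong (suc k ⊓_) (+-∸-assoc 1 k≤n)) (cong (suc (suc n) ⊓_) (n∸n≡0 n)) ⟩
  sumTo n (λ k → suc (k ⊓ (n ∸ k))) + 0
    ≡⟨ +-identityʳ _ ⟩
  sumTo n (λ k → 1 + k ⊓ (n ∸ k))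
    ≡⟨ sumTo-+ n (λ _ → 1) _ ⟩
  sumTo n (λ _ → 1) + minSum n
    ≡⟨ cong (_+ minSum n) (trans (sumTo-const n 1) (*-identityʳ (suc n))) ⟩
  suc n + minSum n
    ≡⟨ +-comm (suc n) _ ⟩
  minSum n + suc n ∎
  where open ≡-Reasoning

minSum+2n+4 : ∀ n → minSum n + (2 * n + 4) ≡ (n + 4) * (n + 4) / 4
minSum+2n+4 zero          = refl
minSum+2n+4 (suc zero)    = refl
minSum+2n+4 (suc (suc n)) = begin
  minSum (suc (suc n)) + (2 * suc (suc n) + 4)            ≡⟨ cong (_+ (2 * suc (suc n) + 4)) (minSum-suc-suc n) ⟩
  minSum n + suc n + (2 * suc (suc n) + 4)                ≡⟨ solve 2 (λ q n → q :+ (con 1 :+ n) :+ (con 2 :* (con 2 :+ n) :+ con 4)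
                                                                  := (q :+ (con 2 :* n :+ con 4)) :+ (n :+ con 5)) refl (minSum n) n ⟩
  (minSum n + (2 * n + 4)) + (n + 5)                      ≡⟨ cong (_+ (n + 5)) (minSum+2n+4 n) ⟩
  (n + 4) * (n + 4) / 4 + (n + 5)                         ≡⟨ cong ((n + 4) * (n + 4) / 4 +_) (m*n/n≡m (n + 5) 4) ⟨
  (n + 4) * (n + 4) / 4 + (n + 5) * 4 / 4                 ≡⟨ +-distrib-/-∣ʳ ((n + 4) * (n + 4)) (divides-refl (n + 5)) ⟨
  ((n + 4) * (n + 4) + (n + 5) * 4) / 4                   ≡⟨ cong (_/ 4) (solve 1 (λ n → (n :+ con 4) :* (n :+ con 4) :+ (n :+ con 5) :* con 4
                                                                  := (con 2 :+ n :+ con 4) :* (con 2 :+ n :+ con 4)) refl n) ⟩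
  (suc (suc n) + 4) * (suc (suc n) + 4) / 4               ∎
  where
  open ≡-Reasoning
  open +-*-Solver

twice-F≡ : ∀ n → 2 * F (n + 3) ≡ length (splits n) + (n + 4) * (n + 4) / 4
twice-F≡ n = begin
  2 * F (n + 3)                                    ≡⟨ cong₂ (λ a b → a + (b + 0)) (F≡ true) (F≡ false) ⟩
  (Ψ₁ + suc n + 1) + ((Ψ₀ + suc n + 1) + 0)        ≡⟨ solve 3 (λ a b n → (a :+ (con 1 :+ n) :+ con 1) :+ ((b :+ (con 1 :+ n) :+ con 1) :+ con 0)
                                                          := (a :+ b) :+ (con 2 :* n :+ con 4)) refl Ψ₁ Ψ₀ n ⟩
  (Ψ₁ + Ψ₀) + (2 * n + 4)                          ≡⟨ cong (_+ (2 * n + 4)) (length-splits+⊓ n) ⟨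
  (length (splits n) + minSum n) + (2 * n + 4)     ≡⟨ +-assoc (length (splits n)) _ _ ⟩
  length (splits n) + (minSum n + (2 * n + 4))     ≡⟨ cong (length (splits n) +_) (minSum+2n+4 n) ⟩
  length (splits n) + (n + 4) * (n + 4) / 4        ∎
  where
  open ≡-Reasoning
  open +-*-Solver
  Ψ₁ = positiveSum true n
  Ψ₀ = positiveSum false n
  F≡ : ∀ β → F (n + 3) ≡ positiveSum β n + suc n + 1
  F≡ β = sym (trans (cong (_+ 1) (positiveSum+suc β n)) (fibCount+1≡F β n))

theorem2p5 : (n : ℕ) → 2 ≤ n →
    count n ≡ (2 * F (n + 3) ∸ ((n + 4) * (n + 4)) / 4) + 1
theorem2p5 n _ = begin
  count n                           ≡⟨ count≡suc-length-splits n ⟩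
  suc L                             ≡⟨ +-comm 1 L ⟩
  L + 1                             ≡⟨ cong (_+ 1) (m+n∸n≡m L X) ⟨
  (L + X ∸ X) + 1                   ≡⟨ cong (λ t → t ∸ X + 1) (twice-F≡ n) ⟨
  (2 * F (n + 3) ∸ X) + 1           ∎
  where
  open ≡-Reasoning
  L = length (splits n)
  X = (n + 4) * (n + 4) / 4
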